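{- Let $q$ be a power of a prime $p$, let $d\ge 2$ with $d\mid(q-1)$, and let $S_d=\{x^d:x\in\mathbb{F}_q^*\}$. Let $A,B\subset\mathbb{F}_q^*$ with $|A|,|B|\ge 2$, and let $\lambda\in\mathbb{F}_q^*$. If $q\ne p$, assume further that $\binom{|A|-1+\frac{q-1}{d}}{|A|}\not\equiv 0\pmod p$. If $AB+\lambda\subset S_d\cup\{0\}$, then $$|A||B|\le |S_d|+|B\cap(-\lambda A^{ -1})|+|A|-1.$$ Moreover, if in addition $\lambda\in S_d$, then $|A||B|\le |S_d|+|B\cap(-\lambda A^{ -1})|-1$.
   Context: $AB=\{ab:a\in A,b\in B\}$, $AB+\lambda=\{x+\lambda:x\in AB\}$, and $-\lambda A^{ -1}=\{ -\lambda a^{ -1}:a\in A\}$. -}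

module Defs where

open import Level using (Level; _⊔_) renaming (suc to lsuc)
open import Data.Nat using (ℕ; zero; suc)
open import Data.Fin using (Fin)
open import Data.Fin.Properties using (any?)
open import Data.Fin.Subset using (Subset; _∈_)
open import Data.Fin.Subset.Properties using (_∈?_)
open import Data.Vec using (tabulate)
open import Data.Product using (∃; _×_; _,_)
open import Data.Sum using (_⊎_)
open import Algebra.Bundles using (CommutativeRing)
open import Relation.Binary.Definitions using (Decidable)
open import Relation.Binary.PropositionalEquality using (_≡_)
open import Relation.Nullary using (¬_; does)
open import Relation.Nullary.Decidable using (¬?; _×-dec_)

-- The inverse is a total function; its value at 0 is irrelevant.
record FiniteField (c ℓ : Level) : Set (lsuc (c ⊔ ℓ)) where
  field
    commRing : CommutativeRing c ℓ
  open CommutativeRing commRing public hiding (ring)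
  field
    _≟_       : Decidable _≈_
    _⁻¹       : Carrier → Carrier
    inverseʳ  : ∀ x → ¬ (x ≈ 0#) → (x * (x ⁻¹)) ≈ 1#
    1≉0       : ¬ (1# ≈ 0#)
    size      : ℕ
    enum      : Fin size → Carrier
    enum-inj  : ∀ i j → enum i ≈ enum j → i ≡ j
    enum-surj : ∀ x → ∃ λ i → enum i ≈ x

module _ {c ℓ : Level} (F : FiniteField c ℓ) where
  open FiniteField F

  natF : ℕ → Carrier
  natF zero    = 0#
  natF (suc n) = 1# + natF n

  -- F has characteristic p (used together with primality of p)
  HasChar : ℕ → Set ℓ
  HasChar p = natF p ≈ 0#

  pow : Carrier → ℕ → Carrier
  pow x zero    = 1#
  pow x (suc n) = x * pow x n

  InSd : ℕ → Carrier → Set (c ⊔ ℓ)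
  InSd d x = ∃ λ y → ¬ (y ≈ 0#) × pow y d ≈ x

  Sd : ℕ → Subset size
  Sd d = tabulate λ i → does (any? λ j → ¬? (enum j ≟ 0#) ×-dec (pow (enum j) d ≟ enum i))

  NonzeroSubset : Subset size → Set ℓ
  NonzeroSubset A = ∀ i → i ∈ A → ¬ (enum i ≈ 0#)

  ProdShiftInSd : ℕ → Subset size → Subset size → Carrier → Set (c ⊔ ℓ)
  ProdShiftInSd d A B λ' = ∀ i j → i ∈ A → j ∈ B →
    ((enum i * enum j) + λ') ≈ 0# ⊎ InSd d ((enum i * enum j) + λ')

  BInterNegLamAInv : Subset size → Subset size → Carrier → Subset size
  BInterNegLamAInv A B λ' = tabulate λ j →
    does ((j ∈? B) ×-dec any? λ i → (i ∈? A) ×-dec (enum j ≟ ((- λ') * (enum i ⁻¹))))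

module Submission where

-- Stepanov's method. Let |A| = m + 1 and r = (q − 1)/d, and take Lagrange weights w_a (a ∈ A)
-- extracting the coefficient of x^m from polynomials of degree ≤ m. The polynomial
--   F(x) = Σ_a w_a a⁻¹ ((a x + λ)^(r+m) − (a x + λ)^m)
-- has degree ≤ r + m, and its coefficient of x^(m+1) is C(r+m, m+1) λ^(r−1), which is nonzero
-- by the binomial hypothesis (for q = p because |A| ≤ r + 1 keeps r + m below p).
-- For b ∈ B each a b + λ is 0 or a d-th power, so (a b + λ)^r is 0 or 1; then the j-th Taylor
-- coefficient of F at b (1 ≤ j ≤ m) is a multiple of Σ_a w_a a^(j−1) (a b + λ)^(m−j), the
-- weighted sum of a polynomial of degree m − 1, and vanishes. Hence b is a root of order m + 1,
-- or of order m when a b + λ = 0 for some a ∈ A, i.e. b ∈ −λ A⁻¹. Counting roots gives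
-- (m + 1)|B| − |B ∩ (−λA⁻¹)| ≤ r + m, and r ≤ |S_d| because every fibre of y ↦ y^d has at
-- most d elements. If λ ∈ S_d, then 0 ∉ B is a further root of order m + 1.

open import Defs
open import Level using (Level; _⊔_)
open import Algebra.Bundles using (CommutativeRing)
open import Data.Nat as ℕ using (ℕ; zero; suc; _∸_; _^_; _≤_; _<_; z≤n; s≤s; NonZero; _!)
import Data.Nat.Properties as ℕ
open import Data.Nat.Tactic.RingSolver using (solve-∀)
open import Data.Nat.Combinatorics using (_C_; k![n∸k]!∣n!; nCk≡n!/k![n-k]!; nCk+nC[k+1]≡[n+1]C[k+1]; k>n⇒nCk≡0; nCn≡1)
open import Data.Nat.Divisibility using (_∣_; ∣-trans; m∣m*n; ∣⇒≤; ∣1⇒≡1; m%n≡0⇒n∣m)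
open import Data.Nat.DivMod using (_/_; _%_; m/n*n≡m; m*[n/m]≡n; m≡m%n+[m/n]*n; m%n<n)
open import Data.Nat.Coprimality using (prime⇒coprime; coprime-Bézout)
open import Data.Nat.GCD using (module Bézout)
open import Data.Nat.Primality using (Prime; euclidsLemma; ¬prime[0]; ¬prime[1]; prime⇒nonTrivial)
open import Data.Bool using (true; false; if_then_else_)
open import Data.Fin using (Fin; zero; suc)
open import Data.Fin.Subset using (Subset; ∣_∣; _∈_; Nonempty)
open import Data.Fin.Subset.Properties using (_∈?_; nonempty?; Empty-unique; ∣⊥∣≡0)
open import Data.Fin.Properties as Fin using (any?)
open import Data.Vec as Vec using (Vec; []; _∷_; tabulate; here; there)
open import Data.Vec.Relation.Binary.Pointwise.Inductive as Pointwise using (Pointwise; []; _∷_)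
open import Data.List as List using (List; []; _∷_)
open import Data.List.Relation.Unary.All as All using (All; []; _∷_)
import Data.List.Relation.Unary.All.Properties as All
import Data.List.Properties as List
open import Data.List.Relation.Unary.AllPairs using (AllPairs; []; _∷_)
open import Data.Product using (Σ; ∃; _×_; _,_; proj₁; proj₂)
open import Data.Sum using (_⊎_; inj₁; inj₂)
open import Data.Empty using (⊥; ⊥-elim)
open import Function using (_∘_; case_of_)
open import Relation.Nullary using (¬_; Dec; yes; no; does)
open import Relation.Nullary.Decidable using (¬?; _×-dec_)
open import Data.Integer using (0ℤ; 1ℤ)
open import Relation.Unary using (Pred; Decidable)
open import Relation.Binary.PropositionalEquality as ≡ using (_≡_; _≢_)
open import Relation.Binary.Definitions using (tri<; tri≈; tri>)

open import Algebra.Properties.CommutativeMonoid.Sum ℕ.+-0-commutativeMonoid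
  using (sum; sum-cong-≋; ∑-distrib-+; ∑-comm)
open import Algebra.Properties.Semiring.Sum ℕ.+-*-semiring using (*-distribˡ-sum)
import Algebra.Properties.CommutativeMonoid.Sum as CommutativeMonoidSum
import Data.Fin.Permutation as Permutation

indicator : ∀ {a} {P : Set a} → Dec P → ℕ
indicator (yes _) = 1
indicator (no _)  = 0

sum-mono-≤ : ∀ {n} {f g : Fin n → ℕ} → (∀ i → f i ≤ g i) → sum f ≤ sum g
sum-mono-≤ {zero}  f≤g = z≤n
sum-mono-≤ {suc n} f≤g = ℕ.+-mono-≤ (f≤g zero) (sum-mono-≤ (f≤g ∘ suc))

sum-const-1 : ∀ n → sum (λ (_ : Fin n) → 1) ≡ n
sum-const-1 zero    = ≡.refl
sum-const-1 (suc n) = ≡.cong suc (sum-const-1 n)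

sum-zero : ∀ {n} {f : Fin n → ℕ} → (∀ i → f i ≡ 0) → sum f ≡ 0
sum-zero {zero}  f≡0 = ≡.refl
sum-zero {suc n} f≡0 = ≡.cong₂ ℕ._+_ (f≡0 zero) (sum-zero (f≡0 ∘ suc))

sum-indicator-unique : ∀ {n p} {P : Pred (Fin n) p} (P? : Decidable P) i → P i → (∀ j → P j → j ≡ i) →
  sum (indicator ∘ P?) ≡ 1
sum-indicator-unique {suc n} P? zero Pi unique with P? zero
... | no ¬Pi = ⊥-elim (¬Pi Pi)
... | yes _  = ≡.cong suc (sum-zero none)
  where
  none : ∀ j → indicator (P? (suc j)) ≡ 0
  none j with P? (suc j)
  ... | yes Pj = case unique (suc j) Pj of λ ()
  ... | no _   = ≡.refl
sum-indicator-unique {suc n} P? (suc i) Pi unique with P? zero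
... | yes P0 = case unique zero P0 of λ ()
... | no _   = sum-indicator-unique (P? ∘ suc) i Pi (λ j Pj → Fin.suc-injective (unique (suc j) Pj))

∣tabulate∣≡∑ : ∀ {n p} {P : Pred (Fin n) p} (P? : Decidable P) →
  ∣ tabulate (does ∘ P?) ∣ ≡ sum (indicator ∘ P?)
∣tabulate∣≡∑ {zero}  P? = ≡.refl
∣tabulate∣≡∑ {suc n} P? with P? zero
... | yes _ = ≡.cong suc (∣tabulate∣≡∑ (P? ∘ suc))
... | no _  = ∣tabulate∣≡∑ (P? ∘ suc)

indicator-∈-there : ∀ {n} x (p : Subset n) i → indicator (i ∈? p) ≡ indicator (suc i ∈? (x ∷ p))
indicator-∈-there x p i with i ∈? p
... | yes _ = ≡.refl
... | no _  = ≡.refl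

∣p∣≡∑∈ : ∀ {n} (p : Subset n) → ∣ p ∣ ≡ sum (λ i → indicator (i ∈? p))
∣p∣≡∑∈ []          = ≡.refl
∣p∣≡∑∈ (true ∷ p)  = ≡.cong suc (≡.trans (∣p∣≡∑∈ p) (sum-cong-≋ (indicator-∈-there true p)))
∣p∣≡∑∈ (false ∷ p) = ≡.trans (∣p∣≡∑∈ p) (sum-cong-≋ (indicator-∈-there false p))

∣p∣>0⇒nonempty : ∀ {n} (p : Subset n) → 0 < ∣ p ∣ → Nonempty p
∣p∣>0⇒nonempty {n} p 0<∣p∣ with nonempty? p
... | yes p≠∅ = p≠∅
... | no p=∅  = ⊥-elim (ℕ.<⇒≢ 0<∣p∣ (≡.sym (≡.trans (≡.cong ∣_∣ (Empty-unique p=∅)) (∣⊥∣≡0 n))))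

elements : ∀ {a} {A : Set a} {n} → (Fin n → A) → Subset n → List A
elements f []          = []
elements f (true ∷ p)  = f zero ∷ elements (f ∘ suc) p
elements f (false ∷ p) = elements (f ∘ suc) p

length-elements : ∀ {a} {A : Set a} {n} (f : Fin n → A) p → List.length (elements f p) ≡ ∣ p ∣
length-elements f []          = ≡.refl
length-elements f (true ∷ p)  = ≡.cong suc (length-elements (f ∘ suc) p)
length-elements f (false ∷ p) = length-elements (f ∘ suc) p

All-elements : ∀ {a q} {A : Set a} {n} {Q : Pred A q} (f : Fin n → A) p →
  (∀ i → i ∈ p → Q (f i)) → All Q (elements f p)
All-elements f []          Q∘f = []
All-elements f (true ∷ p)  Q∘f = Q∘f zero here ∷ All-elements (f ∘ suc) p (λ i → Q∘f (suc i) ∘ there)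
All-elements f (false ∷ p) Q∘f = All-elements (f ∘ suc) p (λ i → Q∘f (suc i) ∘ there)

AllPairs-elements : ∀ {a r} {A : Set a} {n} {R : A → A → Set r} (f : Fin n → A) p →
  (∀ i j → i ≢ j → R (f i) (f j)) → AllPairs R (elements f p)
AllPairs-elements f []          R∘f = []
AllPairs-elements f (true ∷ p)  R∘f =
  All-elements (f ∘ suc) p (λ i _ → R∘f zero (suc i) λ ())
  ∷ AllPairs-elements (f ∘ suc) p (λ i j i≢j → R∘f (suc i) (suc j) (i≢j ∘ Fin.suc-injective))
AllPairs-elements f (false ∷ p) R∘f =
  AllPairs-elements (f ∘ suc) p (λ i j i≢j → R∘f (suc i) (suc j) (i≢j ∘ Fin.suc-injective))

prime∤n! : ∀ {p} → Prime p → ∀ n → n < p → ¬ (p ∣ n !)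
prime∤n! pr zero    _   p∣1 = ¬prime[1] (≡.subst Prime (∣1⇒≡1 p∣1) pr)
prime∤n! pr (suc n) n<p p∣n! with euclidsLemma (suc n) (n !) pr p∣n!
... | inj₁ p∣1+n = ℕ.<-irrefl ≡.refl (ℕ.≤-<-trans (∣⇒≤ p∣1+n) n<p)
... | inj₂ p∣n!  = prime∤n! pr n (ℕ.<-trans (ℕ.n<1+n n) n<p) p∣n!

prime∤nCk : ∀ {p} → Prime p → ∀ {n k} → k ≤ n → n < p → ¬ (p ∣ n C k)
prime∤nCk pr {n} {k} k≤n n<p p∣nCk =
  prime∤n! pr n n<p (≡.subst (_ ∣_) nCk*k![n∸k]!≡n! (∣-trans p∣nCk (m∣m*n _)))
  where
  instance k![n∸k]!≢0 : NonZero (k ! ℕ.* (n ∸ k) !)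
  k![n∸k]!≢0 = ℕ._!*_!≢0 k (n ∸ k)
  nCk*k![n∸k]!≡n! : (n C k) ℕ.* (k ! ℕ.* (n ∸ k) !) ≡ n !
  nCk*k![n∸k]!≡n! = ≡.trans (≡.cong (ℕ._* (k ! ℕ.* (n ∸ k) !)) (nCk≡n!/k![n-k]! k≤n)) (m/n*n≡m (k![n∸k]!∣n! k≤n))

-- The two bounds of Stepanov's method, rearranged into the form of the theorem.
x≤r+m+b⇒x+1≤s+b+[1+m] : ∀ {x b r m s} → x ≤ r ℕ.+ m ℕ.+ b → r ≤ s → x ℕ.+ 1 ≤ s ℕ.+ b ℕ.+ suc m
x≤r+m+b⇒x+1≤s+b+[1+m] {x} {b} {r} {m} {s} x≤ r≤s = begin
  x ℕ.+ 1                   ≤⟨ ℕ.+-monoˡ-≤ 1 (ℕ.≤-trans x≤ (ℕ.+-monoˡ-≤ b (ℕ.+-monoˡ-≤ m r≤s))) ⟩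
  s ℕ.+ m ℕ.+ b ℕ.+ 1       ≡⟨ rearrange s m b ⟩
  s ℕ.+ b ℕ.+ suc m         ∎
  where
  open ℕ.≤-Reasoning
  rearrange : ∀ s m b → s ℕ.+ m ℕ.+ b ℕ.+ 1 ≡ s ℕ.+ b ℕ.+ suc m
  rearrange = solve-∀

x+1+m≤r+m+b⇒x+1≤s+b : ∀ {x b r m s} → x ℕ.+ suc m ≤ r ℕ.+ m ℕ.+ b → r ≤ s → x ℕ.+ 1 ≤ s ℕ.+ b
x+1+m≤r+m+b⇒x+1≤s+b {x} {b} {r} {m} {s} x+1+m≤ r≤s =
  ℕ.≤-trans (ℕ.+-cancelʳ-≤ m (x ℕ.+ 1) (r ℕ.+ b) (≡.subst₂ _≤_ (rearrangeˡ x m) (rearrangeʳ r m b) x+1+m≤)) (ℕ.+-monoˡ-≤ b r≤s)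
  where
  rearrangeˡ : ∀ x m → x ℕ.+ suc m ≡ x ℕ.+ 1 ℕ.+ m
  rearrangeˡ = solve-∀
  rearrangeʳ : ∀ r m b → r ℕ.+ m ℕ.+ b ≡ r ℕ.+ b ℕ.+ m
  rearrangeʳ = solve-∀

module _ {c ℓ : Level} (F : FiniteField c ℓ) where

  open FiniteField F hiding (zero)
  open import Relation.Binary.Reasoning.Setoid setoid
  open import Algebra.Properties.Ring (CommutativeRing.ring commRing)

  private
    module SolverSetup where
      open import Data.Integer as ℤ using (ℤ; +_; -[1+_])
      import Data.Integer.Properties as ℤ
      open import Data.Sign as Sign using (Sign)
      open import Data.Maybe using (Maybe; just; nothing)
      import Relation.Binary.PropositionalEquality as ≡
      import Algebra.Solver.Ring.AlmostCommutativeRing as ACR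
      open import Algebra.Properties.CommutativeSemigroup *-commutativeSemigroup using (interchange)
      open import Algebra.Properties.Semiring.Mult.TCOptimised semiring using (1+×; ×-homo-+; ×1-homo-*)
        renaming (_×_ to _·_)

      -- The optimised _·_ has 1 · x = x definitionally, which the solver's normal forms rely on.
      ⟦_⟧ℤ : ℤ → Carrier
      ⟦ + n ⟧ℤ      = n · 1#
      ⟦ -[1+ n ] ⟧ℤ = - (suc n · 1#)

      ⟦⊖⟧ : ∀ m n → ⟦ m ℤ.⊖ n ⟧ℤ ≈ m · 1# - n · 1#
      ⟦⊖⟧ m       zero    = sym (trans (+-congˡ -0#≈0#) (+-identityʳ _))
      ⟦⊖⟧ zero    (suc n) = sym (+-identityˡ _)
      ⟦⊖⟧ (suc m) (suc n) = begin
        ⟦ suc m ℤ.⊖ suc n ⟧ℤ            ≡⟨ ≡.cong ⟦_⟧ℤ (ℤ.[1+m]⊖[1+n]≡m⊖n m n) ⟩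
        ⟦ m ℤ.⊖ n ⟧ℤ                    ≈⟨ ⟦⊖⟧ m n ⟩
        x - y                           ≈⟨ sym (+-identityˡ _) ⟩
        0# + (x - y)                    ≈⟨ +-congʳ (sym (-‿inverseʳ 1#)) ⟩
        (1# - 1#) + (x - y)             ≈⟨ +-assoc _ _ _ ⟩
        1# + (- 1# + (x - y))           ≈⟨ +-congˡ (sym (+-assoc _ _ _)) ⟩
        1# + ((- 1# + x) - y)           ≈⟨ +-congˡ (+-congʳ (+-comm _ _)) ⟩
        1# + ((x - 1#) - y)             ≈⟨ +-congˡ (+-assoc _ _ _) ⟩
        1# + (x + (- 1# - y))           ≈⟨ +-congˡ (+-congˡ (-‿+-comm 1# y)) ⟩
        1# + (x - (1# + y))             ≈⟨ sym (+-assoc _ _ _) ⟩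
        (1# + x) - (1# + y)             ≈⟨ sym (+-cong (1+× m 1#) (-‿cong (1+× n 1#))) ⟩
        suc m · 1# - suc n · 1#         ∎
        where
        x y : Carrier
        x = m · 1#
        y = n · 1#

      ⟦-⟧ : ∀ i → ⟦ ℤ.- i ⟧ℤ ≈ - ⟦ i ⟧ℤ
      ⟦-⟧ (+ zero)    = sym -0#≈0#
      ⟦-⟧ (+ suc n)   = refl
      ⟦-⟧ -[1+ n ]    = sym (-‿involutive _)

      ⟦+⟧ : ∀ i j → ⟦ i ℤ.+ j ⟧ℤ ≈ ⟦ i ⟧ℤ + ⟦ j ⟧ℤ
      ⟦+⟧ (+ m)    (+ n)    = ×-homo-+ 1# m n
      ⟦+⟧ (+ m)    -[1+ n ] = ⟦⊖⟧ m (suc n)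
      ⟦+⟧ -[1+ m ] (+ n)    = trans (⟦⊖⟧ n (suc m)) (+-comm _ _)
      ⟦+⟧ -[1+ m ] -[1+ n ] = begin
        - (suc (suc (m ℕ.+ n)) · 1#)   ≈⟨ -‿cong (trans (1+× (suc (m ℕ.+ n)) 1#) (+-congˡ (trans (1+× (m ℕ.+ n) 1#) (+-congˡ (×-homo-+ 1# m n))))) ⟩
        - (1# + (1# + (x + y)))         ≈⟨ -‿cong (+-congˡ (trans (sym (+-assoc _ _ _)) (trans (+-congʳ (+-comm _ _)) (+-assoc _ _ _)))) ⟩
        - (1# + (x + (1# + y)))         ≈⟨ -‿cong (sym (+-assoc _ _ _)) ⟩
        - ((1# + x) + (1# + y))         ≈⟨ sym (-‿+-comm _ _) ⟩
        - (1# + x) + - (1# + y)         ≈⟨ sym (+-cong (-‿cong (1+× m 1#)) (-‿cong (1+× n 1#))) ⟩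
        - (suc m · 1#) + - (suc n · 1#) ∎
        where
        x y : Carrier
        x = m · 1#
        y = n · 1#

      ⟦_⟧± : Sign → Carrier
      ⟦ Sign.+ ⟧± = 1#
      ⟦ Sign.- ⟧± = - 1#

      ⟦◃⟧ : ∀ s n → ⟦ s ℤ.◃ n ⟧ℤ ≈ ⟦ s ⟧± * n · 1#
      ⟦◃⟧ s        zero    = sym (zeroʳ _)
      ⟦◃⟧ Sign.+ (suc n) = sym (*-identityˡ _)
      ⟦◃⟧ Sign.- (suc n) = trans (-‿cong (sym (*-identityˡ _))) (-‿distribˡ-* 1# _)

      ⟦⟧ℤ-signAbs : ∀ i → ⟦ i ⟧ℤ ≈ ⟦ ℤ.sign i ⟧± * ℤ.∣ i ∣ · 1#
      ⟦⟧ℤ-signAbs (+ n)    = sym (*-identityˡ _)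
      ⟦⟧ℤ-signAbs -[1+ n ] = trans (-‿cong (sym (*-identityˡ _))) (-‿distribˡ-* 1# _)

      ⟦*⟧± : ∀ s t → ⟦ s Sign.* t ⟧± ≈ ⟦ s ⟧± * ⟦ t ⟧±
      ⟦*⟧± Sign.+ t      = sym (*-identityˡ _)
      ⟦*⟧± Sign.- Sign.+ = sym (*-identityʳ _)
      ⟦*⟧± Sign.- Sign.- = sym (trans (sym (-‿distribˡ-* _ _)) (trans (-‿cong (*-identityˡ _)) (-‿involutive _)))

      ⟦*⟧ : ∀ i j → ⟦ i ℤ.* j ⟧ℤ ≈ ⟦ i ⟧ℤ * ⟦ j ⟧ℤ
      ⟦*⟧ i j = begin
        ⟦ (ℤ.sign i Sign.* ℤ.sign j) ℤ.◃ (ℤ.∣ i ∣ ℕ.* ℤ.∣ j ∣) ⟧ℤ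
          ≈⟨ ⟦◃⟧ (ℤ.sign i Sign.* ℤ.sign j) (ℤ.∣ i ∣ ℕ.* ℤ.∣ j ∣) ⟩
        ⟦ ℤ.sign i Sign.* ℤ.sign j ⟧± * (ℤ.∣ i ∣ ℕ.* ℤ.∣ j ∣) · 1#
          ≈⟨ *-cong (⟦*⟧± (ℤ.sign i) (ℤ.sign j)) (×1-homo-* ℤ.∣ i ∣ ℤ.∣ j ∣) ⟩
        (⟦ ℤ.sign i ⟧± * ⟦ ℤ.sign j ⟧±) * (ℤ.∣ i ∣ · 1# * ℤ.∣ j ∣ · 1#)
          ≈⟨ interchange _ _ _ _ ⟩
        (⟦ ℤ.sign i ⟧± * ℤ.∣ i ∣ · 1#) * (⟦ ℤ.sign j ⟧± * ℤ.∣ j ∣ · 1#)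
          ≈⟨ sym (*-cong (⟦⟧ℤ-signAbs i) (⟦⟧ℤ-signAbs j)) ⟩
        ⟦ i ⟧ℤ * ⟦ j ⟧ℤ ∎

      ⟦⟧ℤ-morphism : ACR._-Raw-AlmostCommutative⟶_ ℤ.+-*-rawRing (ACR.fromCommutativeRing commRing)
      ⟦⟧ℤ-morphism = record
        { ⟦_⟧ = ⟦_⟧ℤ ; +-homo = ⟦+⟧ ; *-homo = ⟦*⟧ ; -‿homo = ⟦-⟧
        ; 0-homo = refl ; 1-homo = refl }

      ⟦⟧ℤ-equal? : ∀ i j → Maybe (⟦ i ⟧ℤ ≈ ⟦ j ⟧ℤ)
      ⟦⟧ℤ-equal? i j with i ℤ.≟ j
      ... | yes ≡.refl = just refl
      ... | no _       = nothing

      open import Algebra.Solver.Ring ℤ.+-*-rawRing (ACR.fromCommutativeRing commRing) ⟦⟧ℤ-morphism ⟦⟧ℤ-equal? public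

    open SolverSetup using (solve; _:=_; _:+_; _:*_; _:-_; :-_; con)

  inverseˡ : ∀ x → x ≉ 0# → (x ⁻¹) * x ≈ 1#
  inverseˡ x x≉0 = trans (*-comm _ _) (inverseʳ x x≉0)

  *-cancelˡ-≉0 : ∀ {x y} → x ≉ 0# → x * y ≈ 0# → y ≈ 0#
  *-cancelˡ-≉0 {x} {y} x≉0 xy≈0 = begin
    y                 ≈⟨ sym (*-identityˡ y) ⟩
    1# * y            ≈⟨ *-congʳ (sym (inverseˡ x x≉0)) ⟩
    ((x ⁻¹) * x) * y  ≈⟨ *-assoc _ _ _ ⟩
    (x ⁻¹) * (x * y)  ≈⟨ *-congˡ xy≈0 ⟩
    (x ⁻¹) * 0#       ≈⟨ zeroʳ _ ⟩
    0#                ∎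

  *-≉0 : ∀ {x y} → x ≉ 0# → y ≉ 0# → x * y ≉ 0#
  *-≉0 x≉0 y≉0 = y≉0 ∘ *-cancelˡ-≉0 x≉0

  x-y≈0⇒x≈y : ∀ {x y} → x - y ≈ 0# → x ≈ y
  x-y≈0⇒x≈y {x} {y} x-y≈0 = begin
    x              ≈⟨ solve 2 (λ x y → x := (x :- y) :+ y) refl x y ⟩
    (x - y) + y    ≈⟨ +-congʳ x-y≈0 ⟩
    0# + y         ≈⟨ +-identityˡ y ⟩
    y              ∎

  x+y≈0⇒x≈-y : ∀ {x y} → x + y ≈ 0# → x ≈ - y
  x+y≈0⇒x≈-y {x} {y} x+y≈0 = x-y≈0⇒x≈y (trans (+-congˡ (-‿involutive y)) x+y≈0)

  x*y≈y⇒x≈1 : ∀ {x y} → y ≉ 0# → x * y ≈ y → x ≈ 1#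
  x*y≈y⇒x≈1 {x} {y} y≉0 xy≈y = x-y≈0⇒x≈y (*-cancelˡ-≉0 y≉0 (begin
    y * (x - 1#)    ≈⟨ solve 2 (λ x y → y :* (x :- con 1ℤ) := x :* y :- y) refl x y ⟩
    x * y - y       ≈⟨ +-congʳ xy≈y ⟩
    y - y           ≈⟨ -‿inverseʳ y ⟩
    0#              ∎))

  pow-cong : ∀ {x y} n → x ≈ y → pow F x n ≈ pow F y n
  pow-cong zero    x≈y = refl
  pow-cong (suc n) x≈y = *-cong x≈y (pow-cong n x≈y)

  pow-+ : ∀ x m n → pow F x (m ℕ.+ n) ≈ pow F x m * pow F x n
  pow-+ x zero    n = sym (*-identityˡ _)
  pow-+ x (suc m) n = trans (*-congˡ (pow-+ x m n)) (sym (*-assoc _ _ _))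

  pow-* : ∀ x m n → pow F x (m ℕ.* n) ≈ pow F (pow F x m) n
  pow-* x m zero    = ≡.subst (λ k → pow F x k ≈ 1#) (≡.sym (ℕ.*-zeroʳ m)) refl
  pow-* x m (suc n) = begin
    pow F x (m ℕ.* suc n)               ≡⟨ ≡.cong (pow F x) (ℕ.*-suc m n) ⟩
    pow F x (m ℕ.+ m ℕ.* n)             ≈⟨ pow-+ x m (m ℕ.* n) ⟩
    pow F x m * pow F x (m ℕ.* n)       ≈⟨ *-congˡ (pow-* x m n) ⟩
    pow F x m * pow F (pow F x m) n     ∎

  pow-1# : ∀ n → pow F 1# n ≈ 1#
  pow-1# zero    = refl
  pow-1# (suc n) = trans (*-identityˡ _) (pow-1# n)

  pow-≉0 : ∀ {x} n → x ≉ 0# → pow F x n ≉ 0#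
  pow-≉0 zero    x≉0 = 1≉0
  pow-≉0 (suc n) x≉0 = *-≉0 x≉0 (pow-≉0 n x≉0)

  natF-+ : ∀ m n → natF F (m ℕ.+ n) ≈ natF F m + natF F n
  natF-+ zero    n = sym (+-identityˡ _)
  natF-+ (suc m) n = trans (+-congˡ (natF-+ m n)) (sym (+-assoc _ _ _))

  natF-* : ∀ m n → natF F (m ℕ.* n) ≈ natF F m * natF F n
  natF-* zero    n = sym (zeroˡ _)
  natF-* (suc m) n = begin
    natF F (n ℕ.+ m ℕ.* n)             ≈⟨ natF-+ n (m ℕ.* n) ⟩
    natF F n + natF F (m ℕ.* n)        ≈⟨ +-cong (sym (*-identityˡ _)) (natF-* m n) ⟩
    1# * natF F n + natF F m * natF F n ≈⟨ sym (distribʳ _ _ _) ⟩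
    (1# + natF F m) * natF F n         ∎

  natF-multiple≈0 : ∀ {m} → natF F m ≈ 0# → ∀ x → natF F (x ℕ.* m) ≈ 0#
  natF-multiple≈0 {m} m≈0 x = trans (natF-* x m) (trans (*-congˡ m≈0) (zeroʳ _))

  natF-suc≉0 : ∀ {a b} → natF F a ≈ 0# → natF F b ≈ 0# → suc a ≢ b
  natF-suc≉0 {a} {b} a≈0 b≈0 1+a≡b = 1≉0 (begin
    1#               ≈⟨ sym (+-identityʳ _) ⟩
    1# + 0#          ≈⟨ +-congˡ (sym a≈0) ⟩
    natF F (suc a)   ≡⟨ ≡.cong (natF F) 1+a≡b ⟩
    natF F b         ≈⟨ b≈0 ⟩
    0#               ∎)

  -- A nonzero remainder n mod p would be invertible mod p, and Bézout would give 1 ≈ 0.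
  natF≈0⇒p∣n : ∀ {p} → Prime p → HasChar F p → ∀ n → natF F n ≈ 0# → p ∣ n
  natF≈0⇒p∣n {zero}            pr = ⊥-elim (¬prime[0] pr)
  natF≈0⇒p∣n {suc zero}        pr = ⊥-elim (¬prime[1] pr)
  natF≈0⇒p∣n {p@(suc (suc _))} pr p≈0 n n≈0 with n % p ℕ.≟ 0
  ... | yes n%p≡0 = m%n≡0⇒n∣m n p n%p≡0
  ... | no n%p≢0  = ⊥-elim (absurd (coprime-Bézout (prime⇒coprime pr {{ℕ.≢-nonZero n%p≢0}} (m%n<n n p))))
    where
    n%p≈0 : natF F (n % p) ≈ 0#
    n%p≈0 = begin
      natF F (n % p)                             ≈⟨ sym (+-identityʳ _) ⟩
      natF F (n % p) + 0#                        ≈⟨ +-congˡ (sym (natF-multiple≈0 p≈0 (n / p))) ⟩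
      natF F (n % p) + natF F (n / p ℕ.* p)      ≈⟨ sym (natF-+ (n % p) (n / p ℕ.* p)) ⟩
      natF F (n % p ℕ.+ n / p ℕ.* p)             ≡⟨ ≡.cong (natF F) (≡.sym (m≡m%n+[m/n]*n n p)) ⟩
      natF F n                                   ≈⟨ n≈0 ⟩
      0#                                         ∎
    absurd : Bézout.Identity 1 p (n % p) → ⊥
    absurd (Bézout.+- x y eq) = natF-suc≉0 (natF-multiple≈0 n%p≈0 y) (natF-multiple≈0 p≈0 x) eq
    absurd (Bézout.-+ x y eq) = natF-suc≉0 (natF-multiple≈0 p≈0 x) (natF-multiple≈0 n%p≈0 y) eq

  binom : ℕ → ℕ → Carrier
  binom n k = natF F (n C k)

  binom-0 : ∀ n → binom n 0 ≈ 1#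
  binom-0 n = +-identityʳ 1#

  binom-pascal : ∀ n k → binom (suc n) (suc k) ≈ binom n k + binom n (suc k)
  binom-pascal n k = trans (reflexive (≡.cong (natF F) (≡.sym (nCk+nC[k+1]≡[n+1]C[k+1] n k)))) (natF-+ (n C k) (n C suc k))

  binom-≈0 : ∀ {n k} → n < k → binom n k ≈ 0#
  binom-≈0 n<k = reflexive (≡.cong (natF F) (k>n⇒nCk≡0 n<k))

  binom-diag : ∀ n → binom n n ≈ 1#
  binom-diag n = trans (reflexive (≡.cong (natF F) (nCn≡1 n))) (+-identityʳ 1#)

  binom≉0 : ∀ {p} → Prime p → HasChar F p → ∀ {n k} → ¬ (p ∣ n C k) → binom n k ≉ 0#
  binom≉0 pr hc {n} {k} p∤nCk = p∤nCk ∘ natF≈0⇒p∣n pr hc (n C k)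

  -- Fermat's little theorem

  index : Carrier → Fin size
  index y = proj₁ (enum-surj y)

  enum∘index : ∀ y → enum (index y) ≈ y
  enum∘index y = proj₂ (enum-surj y)

  index-cong : ∀ {y y'} → y ≈ y' → index y ≡ index y'
  index-cong {y} {y'} y≈y' = enum-inj _ _ (trans (enum∘index y) (trans y≈y' (sym (enum∘index y'))))

  index∘enum : ∀ i → index (enum i) ≡ i
  index∘enum i = enum-inj _ _ (enum∘index (enum i))

  ∑[enum≈y]≡1 : ∀ y → sum (λ i → indicator (enum i ≟ y)) ≡ 1
  ∑[enum≈y]≡1 y = sum-indicator-unique (λ i → enum i ≟ y) (index y) (enum∘index y)
    (λ j j≈y → enum-inj _ _ (trans j≈y (sym (enum∘index y))))

  #nonzero≡size∸1 : sum (λ i → indicator (¬? (enum i ≟ 0#))) ≡ size ∸ 1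
  #nonzero≡size∸1 = ≡.trans (≡.sym (ℕ.m+n∸n≡m _ 1)) (≡.cong (_∸ 1) #nonzero+1≡size)
    where
    #nonzero #zero : Fin size → ℕ
    #nonzero i = indicator (¬? (enum i ≟ 0#))
    #zero i    = indicator (enum i ≟ 0#)
    one : ∀ i → #nonzero i ℕ.+ #zero i ≡ 1
    one i with enum i ≟ 0#
    ... | yes _ = ≡.refl
    ... | no _  = ≡.refl
    #nonzero+1≡size : sum #nonzero ℕ.+ 1 ≡ size
    #nonzero+1≡size =
      ≡.trans (≡.cong (sum #nonzero ℕ.+_) (≡.sym (∑[enum≈y]≡1 0#)))
      (≡.trans (≡.sym (∑-distrib-+ #nonzero #zero))
      (≡.trans (sum-cong-≋ one) (sum-const-1 size)))

  private module Product = CommutativeMonoidSum *-commutativeMonoid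

  ∏ : ∀ {n} → (Fin n → Carrier) → Carrier
  ∏ = Product.sum

  ∏-≉0 : ∀ {n} (f : Fin n → Carrier) → (∀ i → f i ≉ 0#) → ∏ f ≉ 0#
  ∏-≉0 {zero}  f f≉0 = 1≉0
  ∏-≉0 {suc n} f f≉0 = *-≉0 (f≉0 zero) (∏-≉0 (f ∘ suc) (f≉0 ∘ suc))

  ∏-if : ∀ {n p} {P : Pred (Fin n) p} (P? : Decidable P) x →
    ∏ (λ i → if does (P? i) then x else 1#) ≈ pow F x (sum (indicator ∘ P?))
  ∏-if {zero}  P? x = refl
  ∏-if {suc n} P? x with P? zero
  ... | yes _ = *-congˡ (∏-if (P? ∘ suc) x)
  ... | no _  = trans (*-identityˡ _) (∏-if (P? ∘ suc) x)

  -- Multiplication by x ≉ 0 permutes F; comparing the products of all elements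
  -- (with 0 replaced by 1) before and after gives x ^ (q - 1) ≈ 1.
  fermat : ∀ x → x ≉ 0# → pow F x (size ∸ 1) ≈ 1#
  fermat x x≉0 = begin
    pow F x (size ∸ 1)              ≡⟨ ≡.cong (pow F x) (≡.sym #nonzero≡size∸1) ⟩
    pow F x (sum (indicator ∘ P?))  ≈⟨ sym (∏-if P? x) ⟩
    ∏ h                             ≈⟨ x*y≈y⇒x≈1 (∏-≉0 (unit ∘ enum) (unit≉0 ∘ enum)) ∏h*∏≈∏ ⟩
    1#                              ∎
    where
    P? : Decidable (λ i → enum i ≉ 0#)
    P? i = ¬? (enum i ≟ 0#)
    h : Fin size → Carrier
    h i = if does (P? i) then x else 1#
    unit : Carrier → Carrier
    unit y = if does (y ≟ 0#) then 1# else y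
    unit≉0 : ∀ y → unit y ≉ 0#
    unit≉0 y with y ≟ 0#
    ... | yes _   = 1≉0
    ... | no y≉0  = y≉0
    unit-cong : ∀ {y y'} → y ≈ y' → unit y ≈ unit y'
    unit-cong {y} {y'} y≈y' with y ≟ 0# | y' ≟ 0#
    ... | yes _   | yes _    = refl
    ... | yes y≈0 | no y'≉0  = ⊥-elim (y'≉0 (trans (sym y≈y') y≈0))
    ... | no y≉0  | yes y'≈0 = ⊥-elim (y≉0 (trans y≈y' y'≈0))
    ... | no _    | no _     = y≈y'
    unit-x* : ∀ i → unit (x * enum i) ≈ h i * unit (enum i)
    unit-x* i with enum i ≟ 0# | (x * enum i) ≟ 0#
    ... | yes _   | yes _     = sym (*-identityˡ _)
    ... | yes i≈0 | no xi≉0   = ⊥-elim (xi≉0 (trans (*-congˡ i≈0) (zeroʳ x)))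
    ... | no i≉0  | yes xi≈0  = ⊥-elim (*-≉0 x≉0 i≉0 xi≈0)
    ... | no _    | no _      = refl
    σ τ : Fin size → Fin size
    σ i = index (x * enum i)
    τ i = index ((x ⁻¹) * enum i)
    στ : ∀ i → σ (τ i) ≡ i
    στ i = ≡.trans (index-cong (trans (*-congˡ (enum∘index _)) (trans (sym (*-assoc _ _ _))
             (trans (*-congʳ (inverseʳ x x≉0)) (*-identityˡ _))))) (index∘enum i)
    τσ : ∀ i → τ (σ i) ≡ i
    τσ i = ≡.trans (index-cong (trans (*-congˡ (enum∘index _)) (trans (sym (*-assoc _ _ _))
             (trans (*-congʳ (inverseˡ x x≉0)) (*-identityˡ _))))) (index∘enum i)
    ∏h*∏≈∏ : ∏ h * ∏ (unit ∘ enum) ≈ ∏ (unit ∘ enum)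
    ∏h*∏≈∏ = sym (begin
      ∏ (unit ∘ enum)                     ≈⟨ Product.sum-permute (unit ∘ enum) (Permutation.permutation σ τ στ τσ) ⟩
      ∏ (λ i → unit (enum (σ i)))         ≈⟨ Product.sum-cong-≋ (λ i → trans (unit-cong (enum∘index _)) (unit-x* i)) ⟩
      ∏ (λ i → h i * unit (enum i))       ≈⟨ Product.∑-distrib-+ h (unit ∘ enum) ⟩
      ∏ h * ∏ (unit ∘ enum)               ∎)

  InSd⇒pow≈1 : ∀ d r → d ℕ.* r ≡ size ∸ 1 → ∀ {u} → InSd F d u → pow F u r ≈ 1#
  InSd⇒pow≈1 d r d*r≡q-1 {u} (y , y≉0 , y^d≈u) = begin
    pow F u r                ≈⟨ pow-cong r (sym y^d≈u) ⟩
    pow F (pow F y d) r      ≈⟨ sym (pow-* y d r) ⟩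
    pow F y (d ℕ.* r)        ≡⟨ ≡.cong (pow F y) d*r≡q-1 ⟩
    pow F y (size ∸ 1)       ≈⟨ fermat y y≉0 ⟩
    1#                       ∎

  -- Polynomials as coefficient vectors, constant term first

  Poly : ℕ → Set c
  Poly = Vec Carrier

  infix 4 _≋_
  _≋_ : ∀ {n} → Poly n → Poly n → Set (c ⊔ ℓ)
  _≋_ = Pointwise _≈_

  ≋-refl : ∀ {n} {f : Poly n} → f ≋ f
  ≋-refl = Pointwise.refl refl

  ≋-trans : ∀ {n} {f g h : Poly n} → f ≋ g → g ≋ h → f ≋ h
  ≋-trans = Pointwise.trans trans

  zeros : ∀ n → Poly n
  zeros n = Vec.replicate n 0#

  eval : ∀ {n} → Poly n → Carrier → Carrier
  eval []      x = 0#
  eval (a ∷ f) x = a + x * eval f x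

  -- The quotient of f by x − b (synthetic division).
  quot : ∀ {n} → Poly (suc n) → Carrier → Poly n
  quot (a ∷ [])          b = []
  quot (a ∷ f@(_ ∷ _))   b = eval f b ∷ quot f b

  -- The j-th Taylor coefficient of f at b (the j-th Hasse derivative): the value at b
  -- of the j-fold quotient by x − b.
  taylor : ∀ {n} → ℕ → Poly n → Carrier → Carrier
  taylor zero    f       b = eval f b
  taylor (suc j) []      b = 0#
  taylor (suc j) (a ∷ f) b = taylor j (quot (a ∷ f) b) b

  addConst : ∀ {n} → Carrier → Poly (suc n) → Poly (suc n)
  addConst k (a ∷ f) = (k + a) ∷ f

  linMul : ∀ {n} → Carrier → Carrier → Poly n → Poly (suc n)
  linMul α β []      = 0# ∷ []
  linMul α β (a ∷ f) = (β * a) ∷ addConst (α * a) (linMul α β f)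

  eval-cong : ∀ {n} {f g : Poly n} → f ≋ g → ∀ x → eval f x ≈ eval g x
  eval-cong []           x = refl
  eval-cong (a≈b ∷ f≋g)  x = +-cong a≈b (*-congˡ (eval-cong f≋g x))

  quot-cong : ∀ {n} {f g : Poly (suc n)} → f ≋ g → ∀ b → quot f b ≋ quot g b
  quot-cong (_ ∷ [])               b = []
  quot-cong (_ ∷ f≋g@(_ ∷ _))      b = eval-cong f≋g b ∷ quot-cong f≋g b

  taylor-cong : ∀ {n} j {f g : Poly n} → f ≋ g → ∀ b → taylor j f b ≈ taylor j g b
  taylor-cong zero    f≋g          b = eval-cong f≋g b
  taylor-cong (suc j) []           b = refl
  taylor-cong (suc j) f≋g@(_ ∷ _)  b = taylor-cong j (quot-cong f≋g b) b

  addConst-cong : ∀ {n} {k k'} {f g : Poly (suc n)} → k ≈ k' → f ≋ g → addConst k f ≋ addConst k' g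
  addConst-cong k≈k' (a≈b ∷ f≋g) = +-cong k≈k' a≈b ∷ f≋g

  linMul-cong : ∀ {n} α β {f g : Poly n} → f ≋ g → linMul α β f ≋ linMul α β g
  linMul-cong α β []          = refl ∷ []
  linMul-cong α β (a≈b ∷ f≋g) = *-congˡ a≈b ∷ addConst-cong (*-congˡ a≈b) (linMul-cong α β f≋g)

  eval-zeros : ∀ n x → eval (zeros n) x ≈ 0#
  eval-zeros zero    x = refl
  eval-zeros (suc n) x = trans (+-identityˡ _) (trans (*-congˡ (eval-zeros n x)) (zeroʳ _))

  eval-addConst : ∀ {n} k (f : Poly (suc n)) x → eval (addConst k f) x ≈ k + eval f x
  eval-addConst k (a ∷ f) x = +-assoc _ _ _

  eval-linMul : ∀ {n} α β (f : Poly n) x → eval (linMul α β f) x ≈ (α * x + β) * eval f x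
  eval-linMul α β []      x = begin
    0# + x * 0#           ≈⟨ trans (+-identityˡ _) (zeroʳ _) ⟩
    0#                    ≈⟨ sym (zeroʳ _) ⟩
    (α * x + β) * 0#      ∎
  eval-linMul α β (a ∷ f) x = begin
    β * a + x * eval (addConst (α * a) (linMul α β f)) x  ≈⟨ +-congˡ (*-congˡ (eval-addConst _ (linMul α β f) x)) ⟩
    β * a + x * (α * a + eval (linMul α β f) x)           ≈⟨ +-congˡ (*-congˡ (+-congˡ (eval-linMul α β f x))) ⟩
    β * a + x * (α * a + (α * x + β) * eval f x)          ≈⟨ solve 5 (λ α β a x e → β :* a :+ x :* (α :* a :+ (α :* x :+ β) :* e) := (α :* x :+ β) :* (a :+ x :* e)) refl α β a x (eval f x) ⟩
    (α * x + β) * (a + x * eval f x)                      ∎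

  quot-addConst : ∀ {n} k (f : Poly (suc n)) b → quot (addConst k f) b ≋ quot f b
  quot-addConst k (a ∷ [])      b = []
  quot-addConst k (a ∷ (_ ∷ _)) b = ≋-refl

  quot-linMul : ∀ {n} α β (f : Poly (suc n)) b →
    quot (linMul α β f) b ≋ addConst (α * eval f b) (linMul α β (quot f b))
  quot-linMul α β (a ∷ []) b =
    solve 3 (λ α a b → α :* a :+ con 0ℤ :+ b :* con 0ℤ := α :* (a :+ b :* con 0ℤ) :+ con 0ℤ) refl α a b ∷ []
  quot-linMul α β (a ∷ f@(_ ∷ _)) b = head ∷ ≋-trans (quot-addConst (α * a) (linMul α β f) b) (quot-linMul α β f b)
    where
    head : eval (addConst (α * a) (linMul α β f)) b ≈ α * (a + b * eval f b) + β * eval f b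
    head = begin
      eval (addConst (α * a) (linMul α β f)) b  ≈⟨ eval-addConst _ (linMul α β f) b ⟩
      α * a + eval (linMul α β f) b             ≈⟨ +-congˡ (eval-linMul α β f b) ⟩
      α * a + (α * b + β) * eval f b            ≈⟨ solve 5 (λ α β a b e → α :* a :+ (α :* b :+ β) :* e := α :* (a :+ b :* e) :+ β :* e) refl α β a b (eval f b) ⟩
      α * (a + b * eval f b) + β * eval f b     ∎

  taylor-suc-addConst : ∀ {n} j k (f : Poly (suc n)) b → taylor (suc j) (addConst k f) b ≈ taylor (suc j) f b
  taylor-suc-addConst j k f@(_ ∷ _) b = taylor-cong j (quot-addConst k f b) b

  taylor-zeros : ∀ n j b → taylor j (zeros n) b ≈ 0#
  taylor-zeros n             zero    b = eval-zeros n b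
  taylor-zeros zero          (suc j) b = refl
  taylor-zeros (suc zero)    (suc j) b = taylor-zeros 0 j b
  taylor-zeros (suc (suc n)) (suc j) b = trans (taylor-cong j (quot-zeros (suc n)) b) (taylor-zeros (suc n) j b)
    where
    quot-zeros : ∀ m → quot (zeros (suc m)) b ≋ zeros m
    quot-zeros zero    = []
    quot-zeros (suc m) = eval-zeros (suc m) b ∷ quot-zeros m

  taylor-linMul : ∀ {n} j α β (f : Poly n) b →
    taylor (suc j) (linMul α β f) b ≈ (α * b + β) * taylor (suc j) f b + α * taylor j f b
  taylor-linMul j α β [] b = begin
    taylor j [] b                               ≈⟨ taylor-zeros 0 j b ⟩
    0#                                          ≈⟨ sym (trans (+-cong (zeroʳ _) (*-congˡ (taylor-zeros 0 j b))) (trans (+-identityˡ _) (zeroʳ _))) ⟩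
    (α * b + β) * 0# + α * taylor j [] b        ∎
  taylor-linMul zero α β f@(_ ∷ _) b = begin
    eval (quot (linMul α β f) b) b                               ≈⟨ eval-cong (quot-linMul α β f b) b ⟩
    eval (addConst (α * eval f b) (linMul α β (quot f b))) b     ≈⟨ eval-addConst _ (linMul α β (quot f b)) b ⟩
    α * eval f b + eval (linMul α β (quot f b)) b                ≈⟨ +-congˡ (eval-linMul α β (quot f b) b) ⟩
    α * eval f b + (α * b + β) * eval (quot f b) b               ≈⟨ +-comm _ _ ⟩
    (α * b + β) * taylor 1 f b + α * taylor 0 f b                ∎
  taylor-linMul (suc j) α β f@(_ ∷ _) b = begin
    taylor (suc j) (quot (linMul α β f) b) b                             ≈⟨ taylor-cong (suc j) (quot-linMul α β f b) b ⟩
    taylor (suc j) (addConst (α * eval f b) (linMul α β (quot f b))) b   ≈⟨ taylor-suc-addConst j _ (linMul α β (quot f b)) b ⟩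
    taylor (suc j) (linMul α β (quot f b)) b                             ≈⟨ taylor-linMul j α β (quot f b) b ⟩
    (α * b + β) * taylor (suc j) (quot f b) b + α * taylor j (quot f b) b ∎

  division-by-linear : ∀ {n} (f : Poly (suc n)) b → f ≋ addConst (eval f b) (linMul 1# (- b) (quot f b))
  division-by-linear (a ∷ []) b =
    solve 2 (λ a b → a := (a :+ b :* con 0ℤ) :+ con 0ℤ) refl a b ∷ []
  division-by-linear (a ∷ f@(_ ∷ _)) b =
    solve 3 (λ a b e → a := (a :+ b :* e) :+ (:- b) :* e) refl a b (eval f b)
    ∷ ≋-trans (division-by-linear f b) (addConst-cong (sym (*-identityˡ _)) ≋-refl)

  eval-division : ∀ {n} (f : Poly (suc n)) b x → eval f x ≈ eval f b + (x - b) * eval (quot f b) x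
  eval-division f b x = begin
    eval f x                                                   ≈⟨ eval-cong (division-by-linear f b) x ⟩
    eval (addConst (eval f b) (linMul 1# (- b) (quot f b))) x  ≈⟨ eval-addConst _ (linMul 1# (- b) (quot f b)) x ⟩
    eval f b + eval (linMul 1# (- b) (quot f b)) x             ≈⟨ +-congˡ (eval-linMul 1# (- b) (quot f b) x) ⟩
    eval f b + (1# * x + - b) * eval (quot f b) x              ≈⟨ +-congˡ (*-congʳ (+-congʳ (*-identityˡ x))) ⟩
    eval f b + (x - b) * eval (quot f b) x                     ∎

  -- Counting roots with multiplicity

  VanishesToOrder : ∀ {n} → ℕ → Poly n → Carrier → Set ℓ
  VanishesToOrder k f b = ∀ j → j < k → taylor j f b ≈ 0#

  NonzeroPoly : ∀ {n} → Poly n → Set (c ⊔ ℓ)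
  NonzeroPoly f = ¬ (f ≋ zeros _)

  taylor≉0⇒nonzero : ∀ {n} j (f : Poly n) b → taylor j f b ≉ 0# → NonzeroPoly f
  taylor≉0⇒nonzero {n} j f b t≉0 f≋0 = t≉0 (trans (taylor-cong j f≋0 b) (taylor-zeros n j b))

  linMul-zeros : ∀ n α β → linMul α β (zeros n) ≋ zeros (suc n)
  linMul-zeros zero    α β = refl ∷ []
  linMul-zeros (suc n) α β =
    zeroʳ _ ∷ ≋-trans (addConst-cong (zeroʳ _) (linMul-zeros n α β)) (+-identityˡ _ ∷ ≋-refl)

  quot-nonzero : ∀ {n} (f : Poly (suc n)) b → eval f b ≈ 0# → NonzeroPoly f → NonzeroPoly (quot f b)
  quot-nonzero {n} f b fb≈0 f≉0 q≋0 = f≉0 (≋-trans (division-by-linear f b)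
    (≋-trans (addConst-cong fb≈0 (≋-trans (linMul-cong 1# (- b) q≋0) (linMul-zeros n 1# (- b))))
      (+-identityˡ _ ∷ ≋-refl)))

  vanishes-quot : ∀ {n} (f : Poly (suc n)) {b b'} → b' ≉ b → eval f b ≈ 0# →
    ∀ k → VanishesToOrder k f b' → VanishesToOrder k (quot f b) b'
  vanishes-quot {n} f {b} {b'} b'≉b fb≈0 k f-vanishes = vanishes
    where
    g : Poly n
    g = quot f b
    δ : Carrier
    δ = 1# * b' + - b
    δ≉0 : δ ≉ 0#
    δ≉0 δ≈0 = b'≉b (x-y≈0⇒x≈y (trans (+-congʳ (sym (*-identityˡ b'))) δ≈0))
    f≋ : f ≋ addConst (eval f b) (linMul 1# (- b) g)
    f≋ = division-by-linear f b
    vanishes : ∀ j → j < k → taylor j g b' ≈ 0#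
    vanishes zero j<k = *-cancelˡ-≉0 δ≉0 (begin
      δ * eval g b'                                          ≈⟨ sym (eval-linMul 1# (- b) g b') ⟩
      eval (linMul 1# (- b) g) b'                            ≈⟨ sym (+-identityˡ _) ⟩
      0# + eval (linMul 1# (- b) g) b'                       ≈⟨ +-congʳ (sym fb≈0) ⟩
      eval f b + eval (linMul 1# (- b) g) b'                 ≈⟨ sym (eval-addConst _ (linMul 1# (- b) g) b') ⟩
      eval (addConst (eval f b) (linMul 1# (- b) g)) b'      ≈⟨ sym (eval-cong f≋ b') ⟩
      eval f b'                                              ≈⟨ f-vanishes 0 j<k ⟩
      0#                                                     ∎)
    vanishes (suc j) 1+j<k = *-cancelˡ-≉0 δ≉0 (begin
      δ * taylor (suc j) g b'                                       ≈⟨ sym (+-identityʳ _) ⟩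
      δ * taylor (suc j) g b' + 0#                                  ≈⟨ +-congˡ (sym (trans (*-congˡ (vanishes j (ℕ.<-trans (ℕ.n<1+n j) 1+j<k))) (zeroʳ _))) ⟩
      δ * taylor (suc j) g b' + 1# * taylor j g b'                  ≈⟨ sym (taylor-linMul j 1# (- b) g b') ⟩
      taylor (suc j) (linMul 1# (- b) g) b'                         ≈⟨ sym (taylor-suc-addConst j _ (linMul 1# (- b) g) b') ⟩
      taylor (suc j) (addConst (eval f b) (linMul 1# (- b) g)) b'   ≈⟨ sym (taylor-cong (suc j) f≋ b') ⟩
      taylor (suc j) f b'                                           ≈⟨ f-vanishes (suc j) 1+j<k ⟩
      0#                                                            ∎)

  Distinct : ∀ {n} → (Fin n → Carrier) → Set ℓ
  Distinct ps = ∀ i j → i ≢ j → ps i ≉ ps j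

  ∑orders≤degree : ∀ {D} (f : Poly (suc D)) → NonzeroPoly f → ∀ {n} (ps : Fin n → Carrier) (ks : Fin n → ℕ) →
    Distinct ps → (∀ i → VanishesToOrder (ks i) f (ps i)) → sum ks ≤ D

  -- Induction on the degree: the roots at the head point b are divided out one at a time,
  -- and when its order is used up the next point takes its place.
  ∑orders≤degree+ : ∀ {D} (f : Poly (suc D)) → NonzeroPoly f → ∀ {n} b k (ps : Fin n → Carrier) (ks : Fin n → ℕ) →
    (∀ i → ps i ≉ b) → Distinct ps →
    VanishesToOrder k f b → (∀ i → VanishesToOrder (ks i) f (ps i)) → k ℕ.+ sum ks ≤ D
  ∑orders≤degree+ {zero} (a ∷ []) f≉0 b (suc k) ps ks ps≉b distinct b-root _ =
    ⊥-elim (f≉0 (trans (sym (trans (+-congˡ (zeroʳ b)) (+-identityʳ a))) (b-root 0 (s≤s z≤n)) ∷ []))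
  ∑orders≤degree+ {suc D} f@(_ ∷ _) f≉0 b (suc k) ps ks ps≉b distinct b-root ps-roots =
    s≤s (∑orders≤degree+ (quot f b) (quot-nonzero f b fb≈0 f≉0) b k ps ks ps≉b distinct
          (λ j j<k → b-root (suc j) (s≤s j<k))
          (λ i → vanishes-quot f (ps≉b i) fb≈0 (ks i) (ps-roots i)))
    where
    fb≈0 : eval f b ≈ 0#
    fb≈0 = b-root 0 (s≤s z≤n)
  ∑orders≤degree+ f f≉0 {zero}  b zero ps ks ps≉b distinct b-root ps-roots = z≤n
  ∑orders≤degree+ f f≉0 {suc n} b zero ps ks ps≉b distinct b-root ps-roots =
    ∑orders≤degree f f≉0 ps ks distinct ps-roots

  ∑orders≤degree f f≉0 {zero}  ps ks distinct ps-roots = z≤n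
  ∑orders≤degree f f≉0 {suc n} ps ks distinct ps-roots =
    ∑orders≤degree+ f f≉0 (ps zero) (ks zero) (ps ∘ suc) (ks ∘ suc)
      (λ i → distinct (suc i) zero λ ()) (λ i j i≢j → distinct (suc i) (suc j) (i≢j ∘ Fin.suc-injective))
      (ps-roots zero) (ps-roots ∘ suc)

  linPow : Carrier → Carrier → ∀ n → Poly (suc n)
  linPow α β zero    = 1# ∷ []
  linPow α β (suc n) = linMul α β (linPow α β n)

  taylor-linPow : ∀ α β n j b → taylor j (linPow α β n) b ≈ binom n j * (pow F α j * pow F (α * b + β) (n ∸ j))
  taylor-linPow α β zero zero b =
    trans (solve 1 (λ b → con 1ℤ :+ b :* con 0ℤ := con 1ℤ :* (con 1ℤ :* con 1ℤ)) refl b) (*-congʳ (sym (binom-0 0)))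
  taylor-linPow α β zero (suc j) b =
    trans (taylor-zeros 0 j b) (sym (trans (*-congʳ (binom-≈0 {0} {suc j} (s≤s z≤n))) (zeroˡ _)))
  taylor-linPow α β (suc n) zero b = begin
    eval (linMul α β (linPow α β n)) b   ≈⟨ eval-linMul α β (linPow α β n) b ⟩
    u * eval (linPow α β n) b            ≈⟨ *-congˡ (taylor-linPow α β n 0 b) ⟩
    u * (binom n 0 * (1# * pow F u n))   ≈⟨ solve 3 (λ u B U → u :* (B :* (con 1ℤ :* U)) := B :* (con 1ℤ :* (u :* U))) refl u (binom n 0) (pow F u n) ⟩
    binom n 0 * (1# * (u * pow F u n))   ≈⟨ *-congʳ (trans (binom-0 n) (sym (binom-0 (suc n)))) ⟩
    binom (suc n) 0 * (1# * pow F u (suc n)) ∎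
    where
    u : Carrier
    u = α * b + β
  taylor-linPow α β (suc n) (suc j) b = begin
    taylor (suc j) (linMul α β (linPow α β n)) b
      ≈⟨ taylor-linMul j α β (linPow α β n) b ⟩
    u * taylor (suc j) (linPow α β n) b + α * taylor j (linPow α β n) b
      ≈⟨ +-cong (*-congˡ (taylor-linPow α β n (suc j) b)) (*-congˡ (taylor-linPow α β n j b)) ⟩
    u * (B₁ * (α * A * U₁)) + α * (B₀ * (A * U₀))
      ≈⟨ pascal-step ⟩
    (B₀ + B₁) * (α * A * U₀)
      ≈⟨ *-congʳ (sym (binom-pascal n j)) ⟩
    binom (suc n) (suc j) * (α * A * U₀) ∎
    where
    u A B₀ B₁ U₀ U₁ : Carrier
    u = α * b + β
    A = pow F α j
    B₀ = binom n j
    B₁ = binom n (suc j)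
    U₀ = pow F u (n ∸ j)
    U₁ = pow F u (n ∸ suc j)
    B₁≈0-step : n < suc j → u * (B₁ * (α * A * U₁)) + α * (B₀ * (A * U₀)) ≈ (B₀ + B₁) * (α * A * U₀)
    B₁≈0-step n<1+j = begin
      u * (B₁ * (α * A * U₁)) + α * (B₀ * (A * U₀))  ≈⟨ +-congʳ (*-congˡ (*-congʳ (binom-≈0 n<1+j))) ⟩
      u * (0# * (α * A * U₁)) + α * (B₀ * (A * U₀))  ≈⟨ solve 6 (λ u α A U₁ B₀ U₀ → u :* (con 0ℤ :* (α :* A :* U₁)) :+ α :* (B₀ :* (A :* U₀)) := (B₀ :+ con 0ℤ) :* (α :* A :* U₀)) refl u α A U₁ B₀ U₀ ⟩
      (B₀ + 0#) * (α * A * U₀)                       ≈⟨ *-congʳ (+-congˡ (sym (binom-≈0 n<1+j))) ⟩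
      (B₀ + B₁) * (α * A * U₀)                       ∎
    pascal-step : u * (B₁ * (α * A * U₁)) + α * (B₀ * (A * U₀)) ≈ (B₀ + B₁) * (α * A * U₀)
    pascal-step with ℕ.<-cmp j n
    ... | tri< j<n _ _ = begin
      u * (B₁ * (α * A * U₁)) + α * (B₀ * (A * U₀))
        ≈⟨ solve 7 (λ u B₁ α A U₁ B₀ U₀ → u :* (B₁ :* (α :* A :* U₁)) :+ α :* (B₀ :* (A :* U₀)) := (B₀ :+ B₁) :* (α :* A :* U₀) :+ B₁ :* α :* A :* (u :* U₁ :- U₀)) refl u B₁ α A U₁ B₀ U₀ ⟩
      (B₀ + B₁) * (α * A * U₀) + B₁ * α * A * (u * U₁ - U₀)
        ≈⟨ +-congˡ (*-congˡ (trans (+-congʳ (sym U₀≈uU₁)) (-‿inverseʳ U₀))) ⟩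
      (B₀ + B₁) * (α * A * U₀) + B₁ * α * A * 0#
        ≈⟨ trans (+-congˡ (zeroʳ _)) (+-identityʳ _) ⟩
      (B₀ + B₁) * (α * A * U₀) ∎
      where
      U₀≈uU₁ : U₀ ≈ u * U₁
      U₀≈uU₁ = reflexive (≡.cong (pow F u) (ℕ.+-∸-assoc 1 j<n))
    ... | tri≈ _ ≡.refl _ = B₁≈0-step (ℕ.n<1+n j)
    ... | tri> _ _ n<j = B₁≈0-step (ℕ.<-trans n<j (ℕ.n<1+n j))

  eval-linPow : ∀ α β n x → eval (linPow α β n) x ≈ pow F (α * x + β) n
  eval-linPow α β n x = trans (taylor-linPow α β n 0 x) (trans (*-congʳ (binom-0 n)) (trans (*-identityˡ _) (*-identityˡ _)))

  taylor-linPow-diag : ∀ α β n b → taylor n (linPow α β n) b ≈ pow F α n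
  taylor-linPow-diag α β n b = begin
    taylor n (linPow α β n) b                            ≈⟨ taylor-linPow α β n n b ⟩
    binom n n * (pow F α n * pow F (α * b + β) (n ∸ n))  ≈⟨ *-cong (binom-diag n) (*-congˡ (reflexive (≡.cong (pow F _) (ℕ.n∸n≡0 n)))) ⟩
    1# * (pow F α n * 1#)                                ≈⟨ trans (*-identityˡ _) (*-identityʳ _) ⟩
    pow F α n                                            ∎

  -- Multiplying by the constant polynomial 1 lengthens the coefficient vector.
  pad : ∀ r {n} → Poly (suc n) → Poly (suc (r ℕ.+ n))
  pad zero    g = g
  pad (suc r) g = linMul 0# 1# (pad r g)

  taylor-pad : ∀ r {n} (g : Poly (suc n)) j b → taylor j (pad r g) b ≈ taylor j g b
  taylor-pad zero    g j       b = refl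
  taylor-pad (suc r) g zero    b = begin
    eval (linMul 0# 1# (pad r g)) b   ≈⟨ eval-linMul 0# 1# (pad r g) b ⟩
    (0# * b + 1#) * eval (pad r g) b  ≈⟨ solve 2 (λ b x → (con 0ℤ :* b :+ con 1ℤ) :* x := x) refl b _ ⟩
    eval (pad r g) b                  ≈⟨ taylor-pad r g 0 b ⟩
    eval g b                          ∎
  taylor-pad (suc r) g (suc j) b = begin
    taylor (suc j) (linMul 0# 1# (pad r g)) b                                 ≈⟨ taylor-linMul j 0# 1# (pad r g) b ⟩
    (0# * b + 1#) * taylor (suc j) (pad r g) b + 0# * taylor j (pad r g) b    ≈⟨ solve 3 (λ b x y → (con 0ℤ :* b :+ con 1ℤ) :* x :+ con 0ℤ :* y := x) refl b _ _ ⟩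
    taylor (suc j) (pad r g) b                                                ≈⟨ taylor-pad r g (suc j) b ⟩
    taylor (suc j) g b                                                        ∎

  mulXPow : ∀ k {n} → Poly n → Poly (k ℕ.+ n)
  mulXPow zero    g = g
  mulXPow (suc k) g = linMul 1# 0# (mulXPow k g)

  eval-mulXPow : ∀ k {n} (g : Poly n) x → eval (mulXPow k g) x ≈ pow F x k * eval g x
  eval-mulXPow zero    g x = sym (*-identityˡ _)
  eval-mulXPow (suc k) g x = begin
    eval (linMul 1# 0# (mulXPow k g)) x    ≈⟨ eval-linMul 1# 0# (mulXPow k g) x ⟩
    (1# * x + 0#) * eval (mulXPow k g) x   ≈⟨ *-cong (trans (+-identityʳ _) (*-identityˡ x)) (eval-mulXPow k g x) ⟩
    x * (pow F x k * eval g x)             ≈⟨ sym (*-assoc _ _ _) ⟩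
    pow F x (suc k) * eval g x             ∎

  coeff : ∀ {n} → ℕ → Poly n → Carrier
  coeff k       []      = 0#
  coeff zero    (a ∷ f) = a
  coeff (suc k) (a ∷ f) = coeff k f

  coeff-cong : ∀ {n} k {f g : Poly n} → f ≋ g → coeff k f ≈ coeff k g
  coeff-cong k       []          = refl
  coeff-cong zero    (a≈b ∷ _)   = a≈b
  coeff-cong (suc k) (_ ∷ f≋g)   = coeff-cong k f≋g

  coeff-≥length : ∀ {n} k (f : Poly n) → n ≤ k → coeff k f ≈ 0#
  coeff-≥length k       []      _         = refl
  coeff-≥length (suc k) (a ∷ f) (s≤s n≤k) = coeff-≥length k f n≤k

  coeff-quot : ∀ {n} (g : Poly (suc n)) b k → n ≤ suc k → coeff k (quot g b) ≈ coeff (suc k) g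
  coeff-quot (a ∷ [])                     b k       _         = refl
  coeff-quot (a ∷ (a' ∷ []))              b zero    _         = trans (+-congˡ (zeroʳ b)) (+-identityʳ a')
  coeff-quot (a ∷ (a' ∷ (_ ∷ _)))         b zero    (s≤s ())
  coeff-quot (a ∷ f@(_ ∷ _))              b (suc k) (s≤s n≤k) = coeff-quot f b k n≤k

  taylor-at-0 : ∀ {n} j (f : Poly n) → taylor j f 0# ≈ coeff j f
  taylor-at-0 zero    []      = refl
  taylor-at-0 zero    (a ∷ f) = trans (+-congˡ (zeroˡ _)) (+-identityʳ a)
  taylor-at-0 (suc j) []      = refl
  taylor-at-0 (suc j) (a ∷ f) = trans (taylor-at-0 j (quot (a ∷ f) 0#)) (coeff-cong j (quot-at-0 a f))
    where
    quot-at-0 : ∀ {n} a (f : Poly n) → quot (a ∷ f) 0# ≋ f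
    quot-at-0 a []       = []
    quot-at-0 a (a' ∷ f) = trans (+-congˡ (zeroˡ _)) (+-identityʳ a') ∷ quot-at-0 a' f

  infixl 6 _+ₚ_
  _+ₚ_ : ∀ {n} → Poly n → Poly n → Poly n
  _+ₚ_ = Vec.zipWith _+_

  infixl 7 _·ₚ_
  _·ₚ_ : ∀ {n} → Carrier → Poly n → Poly n
  k ·ₚ f = Vec.map (k *_) f

  eval-+ₚ : ∀ {n} (f g : Poly n) x → eval (f +ₚ g) x ≈ eval f x + eval g x
  eval-+ₚ []      []      x = sym (+-identityˡ _)
  eval-+ₚ (a ∷ f) (b ∷ g) x = trans (+-congˡ (*-congˡ (eval-+ₚ f g x)))
    (solve 5 (λ a b x F G → a :+ b :+ x :* (F :+ G) := a :+ x :* F :+ (b :+ x :* G)) refl a b x (eval f x) (eval g x))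

  eval-·ₚ : ∀ {n} k (f : Poly n) x → eval (k ·ₚ f) x ≈ k * eval f x
  eval-·ₚ k []      x = sym (zeroʳ _)
  eval-·ₚ k (a ∷ f) x = trans (+-congˡ (*-congˡ (eval-·ₚ k f x)))
    (solve 4 (λ k a x F → k :* a :+ x :* (k :* F) := k :* (a :+ x :* F)) refl k a x (eval f x))

  quot-+ₚ : ∀ {n} (f g : Poly (suc n)) b → quot (f +ₚ g) b ≋ quot f b +ₚ quot g b
  quot-+ₚ (_ ∷ [])         (_ ∷ [])         b = []
  quot-+ₚ (_ ∷ f@(_ ∷ _))  (_ ∷ g@(_ ∷ _))  b = eval-+ₚ f g b ∷ quot-+ₚ f g b

  quot-·ₚ : ∀ {n} k (f : Poly (suc n)) b → quot (k ·ₚ f) b ≋ k ·ₚ quot f b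
  quot-·ₚ k (_ ∷ [])        b = []
  quot-·ₚ k (_ ∷ f@(_ ∷ _)) b = eval-·ₚ k f b ∷ quot-·ₚ k f b

  taylor-+ₚ : ∀ {n} j (f g : Poly n) b → taylor j (f +ₚ g) b ≈ taylor j f b + taylor j g b
  taylor-+ₚ zero    f          g          b = eval-+ₚ f g b
  taylor-+ₚ (suc j) []         []         b = sym (+-identityˡ _)
  taylor-+ₚ (suc j) f@(_ ∷ _)  g@(_ ∷ _)  b = trans (taylor-cong j (quot-+ₚ f g b) b) (taylor-+ₚ j (quot f b) (quot g b) b)

  taylor-·ₚ : ∀ {n} j k (f : Poly n) b → taylor j (k ·ₚ f) b ≈ k * taylor j f b
  taylor-·ₚ zero    k f         b = eval-·ₚ k f b
  taylor-·ₚ (suc j) k []        b = sym (zeroʳ _)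
  taylor-·ₚ (suc j) k f@(_ ∷ _) b = trans (taylor-cong j (quot-·ₚ k f b) b) (taylor-·ₚ j k (quot f b) b)

  sumL : ∀ {a} {A : Set a} → (A → Carrier) → List A → Carrier
  sumL f []       = 0#
  sumL f (x ∷ xs) = f x + sumL f xs

  sumL-cong : ∀ {a} {A : Set a} {f g : A → Carrier} {xs} → All (λ x → f x ≈ g x) xs → sumL f xs ≈ sumL g xs
  sumL-cong []             = refl
  sumL-cong (fx≈gx ∷ f≈g)  = +-cong fx≈gx (sumL-cong f≈g)

  sumL-≈0 : ∀ {a} {A : Set a} {f : A → Carrier} {xs} → All (λ x → f x ≈ 0#) xs → sumL f xs ≈ 0#
  sumL-≈0 []            = refl
  sumL-≈0 (fx≈0 ∷ f≈0)  = trans (+-cong fx≈0 (sumL-≈0 f≈0)) (+-identityˡ _)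

  sumL-*ˡ : ∀ {a} {A : Set a} k (f : A → Carrier) xs → sumL (λ x → k * f x) xs ≈ k * sumL f xs
  sumL-*ˡ k f []       = sym (zeroʳ _)
  sumL-*ˡ k f (x ∷ xs) = trans (+-congˡ (sumL-*ˡ k f xs)) (sym (distribˡ _ _ _))

  sumₚ : ∀ {a n} {A : Set a} → (A → Poly n) → List A → Poly n
  sumₚ f []       = zeros _
  sumₚ f (x ∷ xs) = f x +ₚ sumₚ f xs

  taylor-sumₚ : ∀ {a n} {A : Set a} j (f : A → Poly n) xs b → taylor j (sumₚ f xs) b ≈ sumL (λ x → taylor j (f x) b) xs
  taylor-sumₚ {n = n} j f []       b = taylor-zeros n j b
  taylor-sumₚ         j f (x ∷ xs) b = trans (taylor-+ₚ j (f x) (sumₚ f xs) b) (+-congˡ (taylor-sumₚ j f xs b))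

  -- Lagrange weights

  weightedSum : List (Carrier × Carrier) → (Carrier → Carrier) → Carrier
  weightedSum W φ = sumL (λ p → proj₂ p * φ (proj₁ p)) W

  weightedSum-cong : ∀ W {φ ψ} → (∀ x → φ x ≈ ψ x) → weightedSum W φ ≈ weightedSum W ψ
  weightedSum-cong W φ≈ψ = sumL-cong (All.universal (λ p → *-congˡ (φ≈ψ (proj₁ p))) W)

  weightedSum-0 : ∀ W → weightedSum W (λ _ → 0#) ≈ 0#
  weightedSum-0 W = sumL-≈0 (All.universal (λ _ → zeroʳ _) W)

  -- Weights w_a on distinct points a₀, …, a_m such that Σ w_a g(a) is the coefficient
  -- of x^m in g for every g of degree ≤ m (the leading coefficient of Lagrange interpolation).
  LagrangeWeights : List Carrier → Set (c ⊔ ℓ)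
  LagrangeWeights as = Σ (List (Carrier × Carrier)) λ W → List.map proj₁ W ≡ as ×
    (∀ {n} (g : Poly n) → n ≤ List.length as → weightedSum W (eval g) ≈ coeff (ℕ.pred (List.length as)) g)

  rescale : Carrier → List (Carrier × Carrier) → List (Carrier × Carrier)
  rescale a₀ = List.map (λ p → proj₁ p , proj₂ p * ((proj₁ p - a₀) ⁻¹))

  -- Dividing the weights by a − a₀ turns evaluation of g into evaluation of g / (x − a₀),
  -- up to a multiple of g(a₀).
  weightedSum-rescale : ∀ a₀ {n} (g : Poly (suc n)) W → All (λ p → proj₁ p ≉ a₀) W →
    weightedSum (rescale a₀ W) (eval g) ≈ sumL proj₂ (rescale a₀ W) * eval g a₀ + weightedSum W (eval (quot g a₀))
  weightedSum-rescale a₀ g []            []              = sym (trans (+-congʳ (zeroˡ _)) (+-identityˡ _))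
  weightedSum-rescale a₀ g ((a , w) ∷ W) (a≉a₀ ∷ W≉a₀) = begin
    w * i * eval g a + weightedSum (rescale a₀ W) (eval g)  ≈⟨ +-cong (*-congˡ (eval-division g a₀ a)) (weightedSum-rescale a₀ g W W≉a₀) ⟩
    w * i * (G₀ + (a - a₀) * Q) + (S * G₀ + R)       ≈⟨ solve 7 (λ w i d G₀ Q S R → (w :* i) :* (G₀ :+ d :* Q) :+ (S :* G₀ :+ R) := (w :* i :+ S) :* G₀ :+ (w :* (i :* d) :* Q :+ R)) refl w i (a - a₀) G₀ Q S R ⟩
    (w * i + S) * G₀ + (w * (i * (a - a₀)) * Q + R)  ≈⟨ +-congˡ (+-congʳ (*-congʳ (trans (*-congˡ (inverseˡ _ a-a₀≉0)) (*-identityʳ w)))) ⟩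
    (w * i + S) * G₀ + (w * Q + R)                   ∎
    where
    i G₀ Q S R : Carrier
    i = (a - a₀) ⁻¹
    G₀ = eval g a₀
    Q = eval (quot g a₀) a
    S = sumL proj₂ (rescale a₀ W)
    R = weightedSum W (eval (quot g a₀))
    a-a₀≉0 : a - a₀ ≉ 0#
    a-a₀≉0 = a≉a₀ ∘ x-y≈0⇒x≈y

  lagrangeWeights : ∀ a₀ as → AllPairs _≉_ (a₀ ∷ as) → LagrangeWeights (a₀ ∷ as)
  lagrangeWeights a₀ [] _ = (a₀ , 1#) ∷ [] , ≡.refl , leading
    where
    leading : ∀ {n} (g : Poly n) → n ≤ 1 → weightedSum ((a₀ , 1#) ∷ []) (eval g) ≈ coeff 0 g
    leading []            _         = trans (+-identityʳ _) (zeroʳ _)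
    leading (g₀ ∷ [])     _         = solve 2 (λ a₀ g₀ → con 1ℤ :* (g₀ :+ a₀ :* con 0ℤ) :+ con 0ℤ := g₀) refl a₀ g₀
    leading (_ ∷ _ ∷ _)   (s≤s ())
  lagrangeWeights a₀ (a₁ ∷ as) (a₀≉as ∷ distinct) with lagrangeWeights a₁ as distinct
  ... | W , W-points , W-leading = (a₀ , - S) ∷ rescale a₀ W , ≡.cong (a₀ ∷_) (≡.trans (≡.sym (List.map-∘ W)) W-points) , leading
    where
    S : Carrier
    S = sumL proj₂ (rescale a₀ W)
    W≉a₀ : All (λ p → proj₁ p ≉ a₀) W
    W≉a₀ = All.map⁻ (All.map (λ a₀≉a → a₀≉a ∘ sym) (≡.subst (All (a₀ ≉_)) (≡.sym W-points) a₀≉as))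
    leading : ∀ {n} (g : Poly n) → n ≤ suc (suc (List.length as)) →
      weightedSum ((a₀ , - S) ∷ rescale a₀ W) (eval g) ≈ coeff (suc (List.length as)) g
    leading []            _          = weightedSum-0 ((a₀ , - S) ∷ rescale a₀ W)
    leading g@(_ ∷ _)     (s≤s n≤)   = begin
      - S * eval g a₀ + weightedSum (rescale a₀ W) (eval g)           ≈⟨ +-congˡ (weightedSum-rescale a₀ g W W≉a₀) ⟩
      - S * eval g a₀ + (S * eval g a₀ + weightedSum W (eval (quot g a₀)))  ≈⟨ solve 3 (λ S G R → :- S :* G :+ (S :* G :+ R) := R) refl S (eval g a₀) _ ⟩
      weightedSum W (eval (quot g a₀))                                ≈⟨ W-leading (quot g a₀) n≤ ⟩
      coeff (List.length as) (quot g a₀)                              ≈⟨ coeff-quot g a₀ (List.length as) n≤ ⟩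
      coeff (suc (List.length as)) g                                  ∎

  powMinus : ∀ d → Carrier → Poly (suc d)
  powMinus d s = addConst (- s) (linPow 1# 0# d)

  eval-powMinus : ∀ d s x → eval (powMinus d s) x ≈ - s + pow F x d
  eval-powMinus d s x = begin
    eval (addConst (- s) (linPow 1# 0# d)) x  ≈⟨ eval-addConst (- s) (linPow 1# 0# d) x ⟩
    - s + eval (linPow 1# 0# d) x             ≈⟨ +-congˡ (trans (eval-linPow 1# 0# d x) (pow-cong d (trans (+-identityʳ _) (*-identityˡ x)))) ⟩
    - s + pow F x d                           ∎

  taylor-powMinus-top : ∀ d .{{_ : NonZero d}} s b → taylor d (powMinus d s) b ≈ 1#
  taylor-powMinus-top d@(suc d') s b = begin
    taylor d (powMinus d s) b           ≈⟨ taylor-suc-addConst d' (- s) (linPow 1# 0# d) b ⟩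
    taylor d (linPow 1# 0# d) b         ≈⟨ taylor-linPow-diag 1# 0# d b ⟩
    pow F 1# d                          ≈⟨ pow-1# d ⟩
    1#                                  ∎

  powMinus-nonzero : ∀ d .{{_ : NonZero d}} s → NonzeroPoly (powMinus d s)
  powMinus-nonzero d s = taylor≉0⇒nonzero d (powMinus d s) 0# (λ top≈0 → 1≉0 (trans (sym (taylor-powMinus-top d s 0#)) top≈0))

  #dthRoots≤d : ∀ d .{{_ : NonZero d}} s → sum (λ i → indicator (pow F (enum i) d ≟ s)) ≤ d
  #dthRoots≤d d s = ∑orders≤degree (powMinus d s) (powMinus-nonzero d s) enum _
    (λ i j i≢j → i≢j ∘ enum-inj i j) root
    where
    root : ∀ i → VanishesToOrder (indicator (pow F (enum i) d ≟ s)) (powMinus d s) (enum i)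
    root i with pow F (enum i) d ≟ s
    ... | no _    = λ _ ()
    ... | yes i^d≈s = λ { zero _ → trans (eval-powMinus d s (enum i)) (trans (+-congˡ i^d≈s) (-‿inverseˡ s))
                        ; (suc _) (s≤s ()) }

  -- Each of the q − 1 nonzero elements is counted in the fibre of its d-th power,
  -- and each fibre has at most d elements.
  r≤∣Sd∣ : ∀ d .{{_ : NonZero d}} r → d ℕ.* r ≡ size ∸ 1 → r ≤ ∣ Sd F d ∣
  r≤∣Sd∣ d r d*r≡q-1 = ℕ.*-cancelˡ-≤ d (≡.subst₂ _≤_ (≡.sym d*r≡∑fibre) ∑d·image≡d*∣Sd∣ (sum-mono-≤ fibre≤d·image))
    where
    maps?′ : ∀ i j → Dec (enum i ≉ 0# × pow F (enum i) d ≈ enum j)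
    maps?′ i j = ¬? (enum i ≟ 0#) ×-dec (pow F (enum i) d ≟ enum j)
    maps? : Fin size → Fin size → ℕ
    maps? i j = indicator (maps?′ i j)
    fibre image : Fin size → ℕ
    fibre j = sum (λ i → maps? i j)
    image j = indicator (any? (λ i → maps?′ i j))
    hit : Fin size → Fin size → ℕ
    hit i j = indicator (pow F (enum i) d ≟ enum j)
    maps?≡ : ∀ i j → maps? i j ≡ indicator (¬? (enum i ≟ 0#)) ℕ.* hit i j
    maps?≡ i j with enum i ≟ 0# | pow F (enum i) d ≟ enum j
    ... | yes _ | _     = ≡.refl
    ... | no _  | yes _ = ≡.refl
    ... | no _  | no _  = ≡.refl
    ∑hit≡1 : ∀ i → sum (hit i) ≡ 1
    ∑hit≡1 i = sum-indicator-unique (λ j → pow F (enum i) d ≟ enum j) (index (pow F (enum i) d)) (sym (enum∘index _))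
      (λ j ≈j → enum-inj _ _ (trans (sym ≈j) (sym (enum∘index _))))
    nonzero≡∑fibre : ∀ i → indicator (¬? (enum i ≟ 0#)) ≡ sum (maps? i)
    nonzero≡∑fibre i = ≡.sym (≡.trans (sum-cong-≋ (maps?≡ i))
      (≡.trans (≡.sym (*-distribˡ-sum nz (hit i))) (≡.trans (≡.cong (nz ℕ.*_) (∑hit≡1 i)) (ℕ.*-identityʳ nz))))
      where
      nz : ℕ
      nz = indicator (¬? (enum i ≟ 0#))
    d*r≡∑fibre : d ℕ.* r ≡ sum fibre
    d*r≡∑fibre = ≡.trans d*r≡q-1 (≡.trans (≡.sym #nonzero≡size∸1) (≡.trans (sum-cong-≋ nonzero≡∑fibre) (∑-comm (λ i j → maps? i j))))
    ∑d·image≡d*∣Sd∣ : sum (λ j → d ℕ.* image j) ≡ d ℕ.* ∣ Sd F d ∣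
    ∑d·image≡d*∣Sd∣ = ≡.trans (≡.sym (*-distribˡ-sum d image)) (≡.cong (d ℕ.*_) (≡.sym (∣tabulate∣≡∑ (λ j → any? (λ i → maps?′ i j)))))
    fibre≤d·image : ∀ j → fibre j ≤ d ℕ.* image j
    fibre≤d·image j with any? (λ i → maps?′ i j)
    ... | no ∄ = ℕ.≤-reflexive (≡.trans (sum-zero none) (≡.sym (ℕ.*-zeroʳ d)))
      where
      none : ∀ i → maps? i j ≡ 0
      none i with maps?′ i j
      ... | yes i↦j = ⊥-elim (∄ (i , i↦j))
      ... | no _    = ≡.refl
    ... | yes _ = ℕ.≤-trans (sum-mono-≤ maps?≤root?) (ℕ.≤-trans (#dthRoots≤d d (enum j)) (ℕ.≤-reflexive (≡.sym (ℕ.*-identityʳ d))))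
      where
      maps?≤root? : ∀ i → maps? i j ≤ indicator (pow F (enum i) d ≟ enum j)
      maps?≤root? i with enum i ≟ 0# | pow F (enum i) d ≟ enum j
      ... | yes _ | _     = z≤n
      ... | no _  | yes _ = s≤s z≤n
      ... | no _  | no _  = z≤n

  -- Stepanov's method

  module Auxiliary (λ' : Carrier) (r m : ℕ) (W : List (Carrier × Carrier)) where

    N : ℕ
    N = r ℕ.+ m

    summand : Carrier × Carrier → Poly (suc N)
    summand (a , w) = (w * a ⁻¹) ·ₚ (linPow a λ' N +ₚ (- 1#) ·ₚ pad r (linPow a λ' m))

    aux : Poly (suc N)
    aux = sumₚ summand W

    taylor-summand : ∀ j b a w → taylor j (summand (a , w)) b ≈
      (w * a ⁻¹) * (binom N j * (pow F a j * pow F (a * b + λ') (N ∸ j)) - binom m j * (pow F a j * pow F (a * b + λ') (m ∸ j)))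
    taylor-summand j b a w = begin
      taylor j (summand (a , w)) b
        ≈⟨ taylor-·ₚ j _ _ b ⟩
      (w * a ⁻¹) * taylor j (linPow a λ' N +ₚ (- 1#) ·ₚ pad r (linPow a λ' m)) b
        ≈⟨ *-congˡ (trans (taylor-+ₚ j _ _ b) (+-congˡ (taylor-·ₚ j (- 1#) _ b))) ⟩
      (w * a ⁻¹) * (taylor j (linPow a λ' N) b + - 1# * taylor j (pad r (linPow a λ' m)) b)
        ≈⟨ *-congˡ (+-cong (taylor-linPow a λ' N j b) (trans (*-congˡ (trans (taylor-pad r _ j b) (taylor-linPow a λ' m j b))) (sym (-‿distribˡ-* 1# _)))) ⟩
      (w * a ⁻¹) * (binom N j * (pow F a j * pow F (a * b + λ') (N ∸ j)) - 1# * (binom m j * (pow F a j * pow F (a * b + λ') (m ∸ j))))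
        ≈⟨ *-congˡ (+-congˡ (-‿cong (*-identityˡ _))) ⟩
      (w * a ⁻¹) * (binom N j * (pow F a j * pow F (a * b + λ') (N ∸ j)) - binom m j * (pow F a j * pow F (a * b + λ') (m ∸ j))) ∎

    taylor-summand-suc : ∀ j b a w → a ≉ 0# → taylor (suc j) (summand (a , w)) b ≈
      (w * pow F a j) * (binom N (suc j) * pow F (a * b + λ') (N ∸ suc j) - binom m (suc j) * pow F (a * b + λ') (m ∸ suc j))
    taylor-summand-suc j b a w a≉0 = begin
      taylor (suc j) (summand (a , w)) b                   ≈⟨ taylor-summand (suc j) b a w ⟩
      (w * i) * (B₁ * (a * A * U₁) - B₂ * (a * A * U₂))    ≈⟨ solve 8 (λ w i a A B₁ U₁ B₂ U₂ → (w :* i) :* (B₁ :* (a :* A :* U₁) :- B₂ :* (a :* A :* U₂)) := ((w :* A) :* (B₁ :* U₁ :- B₂ :* U₂)) :* (i :* a)) refl w i a A B₁ U₁ B₂ U₂ ⟩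
      ((w * A) * (B₁ * U₁ - B₂ * U₂)) * (i * a)            ≈⟨ trans (*-congˡ (inverseˡ a a≉0)) (*-identityʳ _) ⟩
      (w * A) * (B₁ * U₁ - B₂ * U₂)                        ∎
      where
      i A B₁ B₂ U₁ U₂ : Carrier
      i = a ⁻¹
      A = pow F a j
      B₁ = binom N (suc j)
      B₂ = binom m (suc j)
      U₁ = pow F (a * b + λ') (N ∸ suc j)
      U₂ = pow F (a * b + λ') (m ∸ suc j)

    -- The condition under which the two powers in a summand agree at b up to order j.
    Good : ℕ → Carrier → Carrier → Set ℓ
    Good j b a = pow F (a * b + λ') r ≈ 1# ⊎ (a * b + λ' ≈ 0# × j < m)

    good⇒powers-agree : ∀ {j b a} → j ≤ m → Good j b a → pow F (a * b + λ') (N ∸ j) ≈ pow F (a * b + λ') (m ∸ j)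
    good⇒powers-agree {j} {b} {a} j≤m good = begin
      pow F u (N ∸ j)                 ≡⟨ ≡.cong (pow F u) (ℕ.+-∸-assoc r j≤m) ⟩
      pow F u (r ℕ.+ (m ∸ j))         ≈⟨ pow-+ u r (m ∸ j) ⟩
      pow F u r * pow F u (m ∸ j)     ≈⟨ agree good ⟩
      pow F u (m ∸ j)                 ∎
      where
      u : Carrier
      u = a * b + λ'
      agree : Good j b a → pow F u r * pow F u (m ∸ j) ≈ pow F u (m ∸ j)
      agree (inj₁ u^r≈1)         = trans (*-congʳ u^r≈1) (*-identityˡ _)
      agree (inj₂ (u≈0 , j<m))   = trans (*-congˡ u^[m-j]≈0) (trans (zeroʳ _) (sym u^[m-j]≈0))
        where
        u^[m-j]≈0 : pow F u (m ∸ j) ≈ 0#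
        u^[m-j]≈0 = trans (reflexive (≡.cong (pow F u) (ℕ.+-∸-assoc 1 j<m))) (trans (*-congʳ u≈0) (zeroˡ _))

    taylor-summand-good-0 : ∀ b a w → Good 0 b a → taylor 0 (summand (a , w)) b ≈ 0#
    taylor-summand-good-0 b a w good = begin
      taylor 0 (summand (a , w)) b                                         ≈⟨ taylor-summand 0 b a w ⟩
      (w * a ⁻¹) * (binom N 0 * (1# * pow F u N) - binom m 0 * (1# * pow F u m))  ≈⟨ *-congˡ (+-cong (*-cong (binom-0 N) (*-congˡ (good⇒powers-agree z≤n good))) (-‿cong (*-congʳ (binom-0 m)))) ⟩
      (w * a ⁻¹) * (1# * (1# * pow F u m) - 1# * (1# * pow F u m))        ≈⟨ *-congˡ (-‿inverseʳ _) ⟩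
      (w * a ⁻¹) * 0#                                                      ≈⟨ zeroʳ _ ⟩
      0#                                                                   ∎
      where
      u : Carrier
      u = a * b + λ'

    taylor-summand-good-suc : ∀ j b a w → suc j ≤ m → a ≉ 0# → Good (suc j) b a → taylor (suc j) (summand (a , w)) b ≈
      (binom N (suc j) - binom m (suc j)) * (w * (pow F a j * pow F (a * b + λ') (m ∸ suc j)))
    taylor-summand-good-suc j b a w 1+j≤m a≉0 good = begin
      taylor (suc j) (summand (a , w)) b               ≈⟨ taylor-summand-suc j b a w a≉0 ⟩
      (w * A) * (B₁ * pow F u (N ∸ suc j) - B₂ * U)    ≈⟨ *-congˡ (+-congʳ (*-congˡ (good⇒powers-agree 1+j≤m good))) ⟩
      (w * A) * (B₁ * U - B₂ * U)                      ≈⟨ solve 5 (λ w A B₁ B₂ U → (w :* A) :* (B₁ :* U :- B₂ :* U) := (B₁ :- B₂) :* (w :* (A :* U))) refl w A B₁ B₂ U ⟩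
      (B₁ - B₂) * (w * (A * U))                        ∎
      where
      u A B₁ B₂ U : Carrier
      u = a * b + λ'
      A = pow F a j
      B₁ = binom N (suc j)
      B₂ = binom m (suc j)
      U = pow F u (m ∸ suc j)

    taylor-summand-top : ∀ a w → a ≉ 0# → taylor (suc m) (summand (a , w)) 0# ≈
      (binom N (suc m) * pow F λ' (N ∸ suc m)) * (w * pow F a m)
    taylor-summand-top a w a≉0 = begin
      taylor (suc m) (summand (a , w)) 0#                                  ≈⟨ taylor-summand-suc m 0# a w a≉0 ⟩
      (w * A) * (B₁ * pow F u (N ∸ suc m) - B₂ * pow F u (m ∸ suc m))      ≈⟨ *-congˡ (+-cong (*-congˡ (pow-cong (N ∸ suc m) u≈λ)) (-‿cong (*-congʳ (binom-≈0 (ℕ.n<1+n m))))) ⟩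
      (w * A) * (B₁ * pow F λ' (N ∸ suc m) - 0# * pow F u (m ∸ suc m))     ≈⟨ solve 5 (λ w A B₁ Λ U → (w :* A) :* (B₁ :* Λ :- con 0ℤ :* U) := (B₁ :* Λ) :* (w :* A)) refl w A B₁ _ _ ⟩
      (B₁ * pow F λ' (N ∸ suc m)) * (w * A)                                ∎
      where
      u A B₁ B₂ : Carrier
      u = a * 0# + λ'
      u≈λ : u ≈ λ'
      u≈λ = trans (+-congʳ (zeroʳ a)) (+-identityˡ λ')
      A = pow F a m
      B₁ = binom N (suc m)
      B₂ = binom m (suc m)

    module Lagrange (W≉0 : All (λ p → proj₁ p ≉ 0#) W)
             (W-leading : ∀ {n} (g : Poly n) → n ≤ suc m → weightedSum W (eval g) ≈ coeff m g) where

      aux-vanishes : ∀ b j → j ≤ m → All (Good j b ∘ proj₁) W → taylor j aux b ≈ 0#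
      aux-vanishes b zero _ good = trans (taylor-sumₚ 0 summand W b)
        (sumL-≈0 (All.map (λ {p} → taylor-summand-good-0 b (proj₁ p) (proj₂ p)) good))
      aux-vanishes b (suc j) 1+j≤m good = begin
        taylor (suc j) aux b                                    ≈⟨ taylor-sumₚ (suc j) summand W b ⟩
        sumL (λ p → taylor (suc j) (summand p) b) W             ≈⟨ sumL-cong (All.zipWith (λ {p} (a≉0 , good-a) → taylor-summand-good-suc j b (proj₁ p) (proj₂ p) 1+j≤m a≉0 good-a) (W≉0 , good)) ⟩
        sumL (λ p → β * (proj₂ p * φ (proj₁ p))) W              ≈⟨ sumL-*ˡ β _ W ⟩
        β * weightedSum W φ                                     ≈⟨ *-congˡ (weightedSum-cong W (λ x → sym (eval-g x))) ⟩
        β * weightedSum W (eval g)                              ≈⟨ *-congˡ (W-leading g (ℕ.m≤n⇒m≤1+n length-g≤m)) ⟩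
        β * coeff m g                                           ≈⟨ *-congˡ (coeff-≥length m g length-g≤m) ⟩
        β * 0#                                                  ≈⟨ zeroʳ β ⟩
        0#                                                      ∎
        where
        β : Carrier
        β = binom N (suc j) - binom m (suc j)
        φ : Carrier → Carrier
        φ x = pow F x j * pow F (x * b + λ') (m ∸ suc j)
        -- φ is a polynomial of degree m − 1, so its leading coefficient of degree m vanishes.
        g : Poly (j ℕ.+ suc (m ∸ suc j))
        g = mulXPow j (linPow b λ' (m ∸ suc j))
        eval-g : ∀ x → eval g x ≈ φ x
        eval-g x = trans (eval-mulXPow j _ x) (*-congˡ (trans (eval-linPow b λ' (m ∸ suc j) x) (pow-cong (m ∸ suc j) (+-congʳ (*-comm b x)))))
        length-g≤m : j ℕ.+ suc (m ∸ suc j) ≤ m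
        length-g≤m = ℕ.≤-reflexive (≡.trans (ℕ.+-suc j (m ∸ suc j)) (ℕ.m+[n∸m]≡n 1+j≤m))

      aux-top : taylor (suc m) aux 0# ≈ binom N (suc m) * pow F λ' (N ∸ suc m)
      aux-top = begin
        taylor (suc m) aux 0#                                   ≈⟨ taylor-sumₚ (suc m) summand W 0# ⟩
        sumL (λ p → taylor (suc m) (summand p) 0#) W            ≈⟨ sumL-cong (All.map (λ {p} → taylor-summand-top (proj₁ p) (proj₂ p)) W≉0) ⟩
        sumL (λ p → c₀ * (proj₂ p * pow F (proj₁ p) m)) W       ≈⟨ sumL-*ˡ c₀ _ W ⟩
        c₀ * weightedSum W (λ x → pow F x m)                    ≈⟨ *-congˡ (weightedSum-cong W (λ x → sym (trans (eval-linPow 1# 0# m x) (pow-cong m (trans (+-identityʳ _) (*-identityˡ x)))))) ⟩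
        c₀ * weightedSum W (eval (linPow 1# 0# m))              ≈⟨ *-congˡ (W-leading (linPow 1# 0# m) ℕ.≤-refl) ⟩
        c₀ * coeff m (linPow 1# 0# m)                           ≈⟨ *-congˡ (sym (taylor-at-0 m (linPow 1# 0# m))) ⟩
        c₀ * taylor m (linPow 1# 0# m) 0#                       ≈⟨ *-congˡ (trans (taylor-linPow-diag 1# 0# m 0#) (pow-1# m)) ⟩
        c₀ * 1#                                                 ≈⟨ *-identityʳ c₀ ⟩
        c₀                                                      ∎
        where
        c₀ : Carrier
        c₀ = binom N (suc m) * pow F λ' (N ∸ suc m)

      aux-nonzero : binom N (suc m) ≉ 0# → λ' ≉ 0# → NonzeroPoly aux
      aux-nonzero binom≉0 λ≉0 = taylor≉0⇒nonzero (suc m) aux 0#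
        (λ top≈0 → *-≉0 binom≉0 (pow-≉0 (N ∸ suc m) λ≉0) (trans (sym aux-top) top≈0))

      aux-vanishesToOrder : ∀ b k → k ≤ suc m → (∀ {j} → j < k → All (Good j b ∘ proj₁) W) → VanishesToOrder k aux b
      aux-vanishesToOrder b k k≤1+m good j j<k = aux-vanishes b j (ℕ.≤-pred (ℕ.≤-trans j<k k≤1+m)) (good j<k)

  module Stepanov (d r : ℕ) (d*r≡q-1 : d ℕ.* r ≡ size ∸ 1)
    (A B : Subset size) (A≉0 : NonzeroSubset F A) (B≉0 : NonzeroSubset F B)
    (m : ℕ) (∣A∣≡1+m : ∣ A ∣ ≡ suc m) (λ' : Carrier) (λ≉0 : λ' ≉ 0#)
    (AB+λ⊆Sd₀ : ProdShiftInSd F d A B λ') (binom≉0 : binom (r ℕ.+ m) (suc m) ≉ 0#) where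

    weights : LagrangeWeights (elements enum A)
    weights with elements enum A | length-elements enum A | AllPairs-elements {R = _≉_} enum A (λ i j i≢j → i≢j ∘ enum-inj i j)
    ... | a₀ ∷ as | _ | distinct = lagrangeWeights a₀ as distinct
    ... | [] | len≡∣A∣ | _ = case ≡.trans len≡∣A∣ ∣A∣≡1+m of λ ()

    W : List (Carrier × Carrier)
    W = proj₁ weights

    All-W : ∀ {q} {Q : Pred Carrier q} → (∀ i → i ∈ A → Q (enum i)) → All (Q ∘ proj₁) W
    All-W Q∘enum = All.map⁻ (≡.subst (All _) (≡.sym (proj₁ (proj₂ weights))) (All-elements enum A Q∘enum))

    W-leading : ∀ {n} (g : Poly n) → n ≤ suc m → weightedSum W (eval g) ≈ coeff m g
    W-leading g n≤1+m = ≡.subst (λ k → weightedSum W (eval g) ≈ coeff (ℕ.pred k) g) length≡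
      (proj₂ (proj₂ weights) g (≡.subst (_ ≤_) (≡.sym length≡) n≤1+m))
      where
      length≡ : List.length (elements enum A) ≡ suc m
      length≡ = ≡.trans (length-elements enum A) ∣A∣≡1+m

    W≉0 : All (λ p → proj₁ p ≉ 0#) W
    W≉0 = All-W A≉0

    open Auxiliary λ' r m W
    open Lagrange W≉0 W-leading

    Bad : Fin size → Set ℓ
    Bad ib = ∃ λ i → i ∈ A × enum ib ≈ (- λ') * (enum i ⁻¹)

    bad? : ∀ ib → Dec (Bad ib)
    bad? ib = any? (λ i → (i ∈? A) ×-dec (enum ib ≟ ((- λ') * (enum i ⁻¹))))

    -- a b + λ ≈ 0 happens exactly when b ≈ −λ a⁻¹, and otherwise a b + λ ∈ S_d.
    good-on-B : ∀ ib → ib ∈ B → ∀ {j} → j < m ⊎ ¬ Bad ib → All (Good j (enum ib) ∘ proj₁) W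
    good-on-B ib ib∈B {j} j<m⊎¬bad = All-W (good j<m⊎¬bad)
      where
      good : j < m ⊎ ¬ Bad ib → ∀ i → i ∈ A → Good j (enum ib) (enum i)
      good j<m⊎¬bad i i∈A with AB+λ⊆Sd₀ i ib i∈A ib∈B | j<m⊎¬bad
      ... | inj₂ ab+λ∈Sd | _         = inj₁ (InSd⇒pow≈1 d r d*r≡q-1 ab+λ∈Sd)
      ... | inj₁ ab+λ≈0  | inj₁ j<m  = inj₂ (ab+λ≈0 , j<m)
      ... | inj₁ ab+λ≈0  | inj₂ ¬bad = ⊥-elim (¬bad (i , i∈A , b≈-λ/a))
        where
        a≉0 : enum i ≉ 0#
        a≉0 = A≉0 i i∈A
        b≈-λ/a : enum ib ≈ (- λ') * (enum i ⁻¹)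
        b≈-λ/a = begin
          enum ib                           ≈⟨ sym (*-identityˡ _) ⟩
          1# * enum ib                      ≈⟨ *-congʳ (sym (inverseˡ _ a≉0)) ⟩
          (enum i ⁻¹ * enum i) * enum ib    ≈⟨ *-assoc _ _ _ ⟩
          enum i ⁻¹ * (enum i * enum ib)    ≈⟨ *-congˡ (x+y≈0⇒x≈-y ab+λ≈0) ⟩
          enum i ⁻¹ * - λ'                  ≈⟨ *-comm _ _ ⟩
          (- λ') * (enum i ⁻¹)              ∎

    good-at-0 : InSd F d λ' → ∀ {b} → b ≈ 0# → ∀ {j} → All (Good j b ∘ proj₁) W
    good-at-0 λ∈Sd b≈0 = All-W (λ i _ →
      inj₁ (trans (pow-cong r (trans (+-congʳ (trans (*-congˡ b≈0) (zeroʳ _))) (+-identityˡ λ'))) (InSd⇒pow≈1 d r d*r≡q-1 λ∈Sd)))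

    order : ∀ {ib} → Dec (ib ∈ B) → Dec (Bad ib) → ℕ
    order (yes _) (yes _) = m
    order (yes _) (no _)  = suc m
    order (no _)  _       = 0

    orderAt : Fin size → ℕ
    orderAt ib = order (ib ∈? B) (bad? ib)

    vanishes-on-B : ∀ ib → VanishesToOrder (orderAt ib) aux (enum ib)
    vanishes-on-B ib = vanishes (ib ∈? B) (bad? ib)
      where
      vanishes : (ib∈?B : Dec (ib ∈ B)) (bad?ib : Dec (Bad ib)) → VanishesToOrder (order ib∈?B bad?ib) aux (enum ib)
      vanishes (no _)     _         = λ _ ()
      vanishes (yes ib∈B) (yes _)   = aux-vanishesToOrder (enum ib) m (ℕ.n≤1+n m) (λ j<m → good-on-B ib ib∈B (inj₁ j<m))
      vanishes (yes ib∈B) (no ¬bad) = aux-vanishesToOrder (enum ib) (suc m) ℕ.≤-refl (λ _ → good-on-B ib ib∈B (inj₂ ¬bad))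

    distinct : Distinct enum
    distinct i j i≢j = i≢j ∘ enum-inj i j

    ∑orderAt≤N : sum orderAt ≤ N
    ∑orderAt≤N = ∑orders≤degree aux (aux-nonzero binom≉0 λ≉0) enum orderAt distinct vanishes-on-B

    BI : Subset size
    BI = BInterNegLamAInv F A B λ'

    ∑orderAt+∣BI∣ : sum orderAt ℕ.+ ∣ BI ∣ ≡ suc m ℕ.* ∣ B ∣
    ∑orderAt+∣BI∣ =
      ≡.trans (≡.cong (sum orderAt ℕ.+_) (∣tabulate∣≡∑ inBI?))
      (≡.trans (≡.sym (∑-distrib-+ orderAt (indicator ∘ inBI?)))
      (≡.trans (sum-cong-≋ (λ ib → order+inBI (ib ∈? B) (bad? ib)))
      (≡.trans (≡.sym (*-distribˡ-sum (suc m) (λ ib → indicator (ib ∈? B))))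
      (≡.cong (suc m ℕ.*_) (≡.sym (∣p∣≡∑∈ B))))))
      where
      inBI? : ∀ ib → Dec (ib ∈ B × Bad ib)
      inBI? ib = (ib ∈? B) ×-dec bad? ib
      order+inBI : ∀ {ib} (ib∈?B : Dec (ib ∈ B)) (bad?ib : Dec (Bad ib)) →
        order ib∈?B bad?ib ℕ.+ indicator (ib∈?B ×-dec bad?ib) ≡ suc m ℕ.* indicator ib∈?B
      order+inBI (yes _) (yes _) = ≡.trans (ℕ.+-comm m 1) (≡.sym (ℕ.*-identityʳ (suc m)))
      order+inBI (yes _) (no _)  = ≡.trans (ℕ.+-identityʳ (suc m)) (≡.sym (ℕ.*-identityʳ (suc m)))
      order+inBI (no _)  _       = ≡.sym (ℕ.*-zeroʳ (suc m))

    bound : suc m ℕ.* ∣ B ∣ ≤ N ℕ.+ ∣ BI ∣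
    bound = ≡.subst (_≤ N ℕ.+ ∣ BI ∣) ∑orderAt+∣BI∣ (ℕ.+-monoˡ-≤ ∣ BI ∣ ∑orderAt≤N)

    -- If λ ∈ S_d, then 0 ∉ B is a further root of order m + 1.
    bound-λ∈Sd : InSd F d λ' → suc m ℕ.* ∣ B ∣ ℕ.+ suc m ≤ N ℕ.+ ∣ BI ∣
    bound-λ∈Sd λ∈Sd = ≡.subst (_≤ N ℕ.+ ∣ BI ∣) rearrange
      (ℕ.+-monoˡ-≤ ∣ BI ∣ (≡.subst (_≤ N) ∑orderAt₀ (∑orders≤degree aux (aux-nonzero binom≉0 λ≉0) enum orderAt₀ distinct vanishes₀)))
      where
      orderAt₀ : Fin size → ℕ
      orderAt₀ ib = orderAt ib ℕ.+ suc m ℕ.* indicator (enum ib ≟ 0#)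
      ∑orderAt₀ : sum orderAt₀ ≡ sum orderAt ℕ.+ suc m
      ∑orderAt₀ = ≡.trans (∑-distrib-+ orderAt _) (≡.cong (sum orderAt ℕ.+_)
        (≡.trans (≡.sym (*-distribˡ-sum (suc m) (λ ib → indicator (enum ib ≟ 0#)))) (≡.trans (≡.cong (suc m ℕ.*_) (∑[enum≈y]≡1 0#)) (ℕ.*-identityʳ (suc m)))))
      rearrange : sum orderAt ℕ.+ suc m ℕ.+ ∣ BI ∣ ≡ suc m ℕ.* ∣ B ∣ ℕ.+ suc m
      rearrange = ≡.trans (ℕ.+-assoc (sum orderAt) (suc m) ∣ BI ∣) (≡.trans (≡.cong (sum orderAt ℕ.+_) (ℕ.+-comm (suc m) ∣ BI ∣))
        (≡.trans (≡.sym (ℕ.+-assoc (sum orderAt) ∣ BI ∣ (suc m))) (≡.cong (ℕ._+ suc m) ∑orderAt+∣BI∣)))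
      orderAt-∉B : ∀ ib → ¬ ib ∈ B → orderAt ib ≡ 0
      orderAt-∉B ib ib∉B with ib ∈? B
      ... | yes ib∈B = ⊥-elim (ib∉B ib∈B)
      ... | no _     = ≡.refl
      vanishes₀ : ∀ ib → VanishesToOrder (orderAt₀ ib) aux (enum ib)
      vanishes₀ ib with enum ib ≟ 0#
      ... | yes ib≈0 = ≡.subst (λ k → VanishesToOrder (k ℕ.+ suc m ℕ.* 1) aux (enum ib)) (≡.sym (orderAt-∉B ib (λ ib∈B → B≉0 ib ib∈B ib≈0)))
        (aux-vanishesToOrder (enum ib) (suc m ℕ.* 1) (ℕ.≤-reflexive (ℕ.*-identityʳ (suc m))) (λ _ → good-at-0 λ∈Sd ib≈0))
      ... | no _     = ≡.subst (λ k → VanishesToOrder k aux (enum ib))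
        (≡.sym (≡.trans (≡.cong (orderAt ib ℕ.+_) (ℕ.*-zeroʳ (suc m))) (ℕ.+-identityʳ _))) (vanishes-on-B ib)

  -- The values a b + λ (a ∈ A) for a fixed b ∈ B are distinct roots of x (x ^ r − 1).
  ∣A∣≤1+r : ∀ d r .{{_ : NonZero r}} → d ℕ.* r ≡ size ∸ 1 → (A B : Subset size) → NonzeroSubset F B → 0 < ∣ B ∣ →
    ∀ λ' → ProdShiftInSd F d A B λ' → ∣ A ∣ ≤ suc r
  ∣A∣≤1+r d r d*r≡q-1 A B B≉0 0<∣B∣ λ' AB+λ⊆Sd₀ with ∣p∣>0⇒nonempty B 0<∣B∣
  ... | b₀ , b₀∈B = ≡.subst (_≤ suc r) (≡.sym (∣p∣≡∑∈ A))
    (∑orders≤degree h h≉0 (λ i → enum i * b + λ') (λ i → indicator (i ∈? A)) distinct (λ i → root (i ∈? A)))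
    where
    b : Carrier
    b = enum b₀
    h : Poly (suc (suc r))
    h = linMul 1# 0# (powMinus r 1#)
    eval-h : ∀ u → eval h u ≈ u * (- 1# + pow F u r)
    eval-h u = trans (eval-linMul 1# 0# (powMinus r 1#) u) (*-cong (trans (+-identityʳ _) (*-identityˡ u)) (eval-powMinus r 1# u))
    h≉0 : NonzeroPoly h
    h≉0 = taylor≉0⇒nonzero (suc r) h 0# (λ top≈0 → 1≉0 (begin
      1#                                                                         ≈⟨ sym (trans (+-congʳ (trans (*-congʳ (trans (+-identityʳ _) (zeroʳ _))) (zeroˡ _))) (trans (+-identityˡ _) (trans (*-identityˡ _) (taylor-powMinus-top r 1# 0#)))) ⟩
      (1# * 0# + 0#) * taylor (suc r) (powMinus r 1#) 0# + 1# * taylor r (powMinus r 1#) 0# ≈⟨ sym (taylor-linMul r 1# 0# (powMinus r 1#) 0#) ⟩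
      taylor (suc r) h 0#                                                        ≈⟨ top≈0 ⟩
      0#                                                                         ∎))
    root : ∀ {i} (i∈?A : Dec (i ∈ A)) → VanishesToOrder (indicator i∈?A) h (enum i * b + λ')
    root         (no _)      = λ _ ()
    root {i}     (yes i∈A) zero _ with AB+λ⊆Sd₀ i b₀ i∈A b₀∈B
    ... | inj₁ u≈0  = trans (eval-h _) (trans (*-congʳ u≈0) (zeroˡ _))
    ... | inj₂ u∈Sd = trans (eval-h _) (trans (*-congˡ (trans (+-congˡ (InSd⇒pow≈1 d r d*r≡q-1 u∈Sd)) (-‿inverseˡ 1#))) (zeroʳ _))
    root         (yes _)   (suc _) (s≤s ())
    distinct : Distinct (λ i → enum i * b + λ')
    distinct i j i≢j ui≈uj = i≢j (enum-inj i j (x-y≈0⇒x≈y (*-cancelˡ-≉0 (B≉0 b₀ b₀∈B) (begin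
      b * (enum i - enum j)                      ≈⟨ solve 4 (λ x y b l → b :* (x :- y) := (x :* b :+ l) :- (y :* b :+ l)) refl (enum i) (enum j) b λ' ⟩
      (enum i * b + λ') - (enum j * b + λ')      ≈⟨ +-congʳ ui≈uj ⟩
      (enum j * b + λ') - (enum j * b + λ')      ≈⟨ -‿inverseʳ _ ⟩
      0#                                         ∎))))

  -- For q = p, the bound |A| ≤ r + 1 keeps r + m below p, so p ∤ C(r + m, m + 1).
  binom≉0-q≡p : ∀ {p} → Prime p → HasChar F p → size ≡ p → ∀ d r → 2 ≤ d → d ℕ.* r ≡ size ∸ 1 →
    (A B : Subset size) → NonzeroSubset F B → 0 < ∣ B ∣ → ∀ λ' → ProdShiftInSd F d A B λ' →
    ∀ m → ∣ A ∣ ≡ suc m → binom (r ℕ.+ m) (suc m) ≉ 0#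
  binom≉0-q≡p {p} pr hc q≡p d r 2≤d d*r≡q-1 A B B≉0 0<∣B∣ λ' AB+λ⊆Sd₀ m ∣A∣≡1+m =
    binom≉0 pr hc {r ℕ.+ m} {suc m} (prime∤nCk pr (ℕ.+-monoˡ-≤ m 0<r) r+m<p)
    where
    1≤q-1 : 1 ≤ size ∸ 1
    1≤q-1 = ℕ.∸-monoˡ-≤ 1 (≡.subst (2 ≤_) (≡.sym q≡p) (ℕ.nonTrivial⇒n>1 p {{prime⇒nonTrivial pr}}))
    0<r : 0 < r
    0<r = ℕ.n≢0⇒n>0 (λ r≡0 → ℕ.<⇒≢ 1≤q-1
      (≡.trans (≡.sym (≡.trans (≡.cong (d ℕ.*_) r≡0) (ℕ.*-zeroʳ d))) d*r≡q-1))
    instance r≢0 : NonZero r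
    r≢0 = ℕ.>-nonZero 0<r
    m≤r : m ≤ r
    m≤r = ℕ.≤-pred (≡.subst (_≤ suc r) ∣A∣≡1+m (∣A∣≤1+r d r d*r≡q-1 A B B≉0 0<∣B∣ λ' AB+λ⊆Sd₀))
    r+m≤q-1 : r ℕ.+ m ≤ size ∸ 1
    r+m≤q-1 = ℕ.≤-trans (ℕ.+-monoʳ-≤ r m≤r) (ℕ.≤-trans
      (≡.subst (_≤ d ℕ.* r) (≡.cong (r ℕ.+_) (ℕ.+-identityʳ r)) (ℕ.*-monoˡ-≤ r 2≤d)) (ℕ.≤-reflexive d*r≡q-1))
    r+m<p : r ℕ.+ m < p
    r+m<p = ≡.subst₂ _≤_ (ℕ.+-comm (r ℕ.+ m) 1) q≡p (ℕ.m≤o∸n⇒m+n≤o (r ℕ.+ m) (ℕ.≤-trans (s≤s z≤n) (ℕ.≤-trans 1≤q-1 (ℕ.m∸n≤m size 1))) r+m≤q-1)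

open import Data.Nat using (_+_; _*_)

theorem1p7 : ∀ {c ℓ : Level} (F : FiniteField c ℓ) (p k d : ℕ) .{{_ : NonZero d}} →
    Prime p → HasChar F p → FiniteField.size F ≡ p ^ suc k →
    2 ≤ d → d ∣ (FiniteField.size F ∸ 1) →
    (A B : Subset (FiniteField.size F)) → NonzeroSubset F A → NonzeroSubset F B →
    2 ≤ ∣ A ∣ → 2 ≤ ∣ B ∣ →
    (λ' : FiniteField.Carrier F) → ¬ (FiniteField._≈_ F λ' (FiniteField.0# F)) →
    (FiniteField.size F ≢ p →
      ¬ (p ∣ (((∣ A ∣ ∸ 1) + ((FiniteField.size F ∸ 1) / d)) C ∣ A ∣))) →
    ProdShiftInSd F d A B λ' →
    (∣ A ∣ * ∣ B ∣ + 1 ≤ ∣ Sd F d ∣ + ∣ BInterNegLamAInv F A B λ' ∣ + ∣ A ∣)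
    × (InSd F d λ' → ∣ A ∣ * ∣ B ∣ + 1 ≤ ∣ Sd F d ∣ + ∣ BInterNegLamAInv F A B λ' ∣)
theorem1p7 F p k d pr hc _ 2≤d d∣q-1 A B A≉0 B≉0 2≤∣A∣ 2≤∣B∣ λ' λ≉0 p∤binom AB+λ⊆Sd₀ =
  ≡.subst (λ a → a * ∣ B ∣ + 1 ≤ ∣ Sd F d ∣ + ∣ BI ∣ + a) (≡.sym ∣A∣≡1+m)
    (x≤r+m+b⇒x+1≤s+b+[1+m] S.bound (r≤∣Sd∣ F d r d*r≡q-1)) ,
  λ λ∈Sd → ≡.subst (λ a → a * ∣ B ∣ + 1 ≤ ∣ Sd F d ∣ + ∣ BI ∣) (≡.sym ∣A∣≡1+m)
    (x+1+m≤r+m+b⇒x+1≤s+b (S.bound-λ∈Sd λ∈Sd) (r≤∣Sd∣ F d r d*r≡q-1))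
  where
  open FiniteField F using (size; _≉_; 0#)
  r m : ℕ
  r = (size ∸ 1) / d
  m = ∣ A ∣ ∸ 1
  d*r≡q-1 : d * r ≡ size ∸ 1
  d*r≡q-1 = m*[n/m]≡n d∣q-1
  ∣A∣≡1+m : ∣ A ∣ ≡ suc m
  ∣A∣≡1+m = ≡.sym (ℕ.suc-pred ∣ A ∣ {{ℕ.>-nonZero (ℕ.≤-trans (s≤s z≤n) 2≤∣A∣)}})
  0<∣B∣ : 0 < ∣ B ∣
  0<∣B∣ = ℕ.≤-trans (s≤s z≤n) 2≤∣B∣
  BI : Subset size
  BI = BInterNegLamAInv F A B λ'
  C[r+m,m+1]≉0 : binom F (r + m) (suc m) ≉ 0#
  C[r+m,m+1]≉0 with size ℕ.≟ p
  ... | yes q≡p = binom≉0-q≡p F pr hc q≡p d r 2≤d d*r≡q-1 A B B≉0 0<∣B∣ λ' AB+λ⊆Sd₀ m ∣A∣≡1+m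
  ... | no q≢p  = binom≉0 F pr hc {r + m} {suc m} (p∤binom q≢p ∘ ≡.subst (p ∣_) (≡.cong₂ _C_ (ℕ.+-comm r m) (≡.sym ∣A∣≡1+m)))
  module S = Stepanov F d r d*r≡q-1 A B A≉0 B≉0 m ∣A∣≡1+m λ' λ≉0 AB+λ⊆Sd₀ C[r+m,m+1]≉0
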